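{- Let $n=p_1^{\alpha_1}p_2^{\alpha_2}p_3^{\alpha_3}$, where $\alpha_1,\alpha_2,\alpha_3$ are positive integers and $p_1<p_2<p_3$ are prime numbers. If $p_3\geq 2p_2+1$, then $\delta(\mathcal{P}(C_n))=\deg(p_3^{\alpha_3})$.
   Context: For a finite group $G$, the power graph $\mathcal{P}(G)$ is the simple undirected graph with vertex set $G$ in which two distinct vertices are adjacent if one of them is an integral power of the other. $C_n$ denotes the cyclic group of order $n$, identified with $\mathbb{Z}_n=\{0,1,\ldots,n-1\}$; a positive divisor $d$ of $n$ is regarded as the vertex $d \bmod n$. $\deg(a)$ denotes the degree of vertex $a$ in $\mathcal{P}(C_n)$ and $\delta(\mathcal{P}(C_n))$ the minimum degree. -}

module Defs where

open import Data.Nat using (ℕ; _*_; _≡ᵇ_; _⊓_; NonZero)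
open import Data.Nat.DivMod using (_%_)
open import Data.Bool using (Bool; _∧_; _∨_; not)
open import Data.Bool.ListAction using (any)
open import Data.List using (List; upTo; filter; length; foldr; map)
open import Relation.Nullary.Decidable using (does)
open import Data.Bool.Properties using (T?)

-- Cyclic group C_n identified with Z_n = {0,…,n-1} (written additively).
-- "b is an integral power of a" in C_n  ⇔  b ≡ k·a (mod n) for some integer k;
-- since k·a mod n is n-periodic in k, it suffices to let k range over 0,…,n-1.
isPowerOf : (n : ℕ) → .{{NonZero n}} → (b a : ℕ) → Bool
isPowerOf n b a = any (λ k → ((k * a) % n) ≡ᵇ b) (upTo n)

adjacent : (n : ℕ) → .{{NonZero n}} → (a b : ℕ) → Bool
adjacent n a b = not (a ≡ᵇ b) ∧ (isPowerOf n b a ∨ isPowerOf n a b)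

deg : (n : ℕ) → .{{NonZero n}} → (a : ℕ) → ℕ
deg n a = length (filter (λ b → T? (adjacent n a b)) (upTo n))

minDeg : (n : ℕ) → .{{NonZero n}} → ℕ
minDeg n = foldr _⊓_ (deg n 0) (map (deg n) (upTo n))

module Submission where

-- In ℤₙ, b is a power of a iff gcd(a, n) ∣ b, so deg(a) + 1 = |N[a]| for the closed neighbourhood
-- N[a] = { b : gcd(a, n) ∣ b or gcd(b, n) ∣ a }.  If gcd(a, n) = d = p₁^e₁ p₂^e₂ p₃^e₃, then N[a]
-- contains M ∪ T, where M are the multiples of d and T = { b : gcd(b, n) ∣ d }; for a = p₃^α₃ it is
-- contained in M ∪ T.  Under the Chinese remainder theorem M, T and M ∩ T are boxes, so their sizes
-- are products of local counts at each prime, whose possible shapes are listed by `Profile`.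
-- Inclusion–exclusion gives |M ∪ T| = n - K for an explicit cross term K of the local counts, and
-- the heart of the argument is the polynomial estimate K(e₁, e₂, e₃) ≤ K(0, 0, α₃), which is where
-- p₃ ≥ 2p₂ + 1 is used.

open import Defs
open import Data.Nat using (ℕ; _*_; _^_; _<_; _≤_; _+_; NonZero)
open import Data.Nat.DivMod using (_%_)
open import Data.Nat.Primality using (Prime)
open import Relation.Binary.PropositionalEquality using (_≡_)

open import Data.Nat.Base
open import Data.Nat.Properties
open import Data.Nat.DivMod
open import Data.Nat.Divisibility
open import Data.Nat.GCD
open import Data.Nat.Coprimality using (Coprime; coprime-divisor) renaming (sym to Coprime-sym)
open import Data.Nat.Primality using (prime⇒nonTrivial; prime⇒nonZero; prime⇒irreducible; euclidsLemma)
open import Data.Nat.Tactic.RingSolver using (solve-∀)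
open import Data.Bool.Base using (Bool; true; false; _∧_; _∨_; not)
open import Data.Bool.Properties using (T-≡; ∧-comm; ∧-identityʳ; ∧-zeroʳ; ∧-commutativeMonoid)
open import Algebra.Bundles using (CommutativeMonoid)
open import Algebra.Properties.CommutativeSemigroup (CommutativeMonoid.commutativeSemigroup ∧-commutativeMonoid)
  using () renaming (interchange to ∧-interchange)
open import Data.Product using (_×_; _,_; proj₁; proj₂; ∃-syntax)
open import Data.Sum using (_⊎_; inj₁; inj₂)
open import Data.Empty using (⊥-elim)
open import Data.List.Base using (upTo; filter; length; _++_; [_]; map; foldr)
open import Data.List.Properties using (upTo-∷ʳ; filter-++; length-++; foldr-preservesᵇ; foldr-preservesᵒ)
open import Data.List.Relation.Unary.All.Properties using (applyUpTo⁺₁) renaming (map⁺ to All-map⁺)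
open import Data.List.Relation.Unary.Any.Properties using (any⁺; any⁻) renaming (map⁺ to Any-map⁺)
open import Data.List.Membership.Propositional using (find; lose)
open import Data.List.Membership.Propositional.Properties using (∈-upTo⁺)
open import Function using (_∘_)
open import Function.Bundles using (Equivalence)
open import Relation.Binary.PropositionalEquality hiding ([_])
open import Relation.Nullary using (¬_; Dec; does; yes; no)
open import Relation.Nullary.Decidable using (dec-true; dec-false; T?)

indicator : Bool → ℕ
indicator true  = 1
indicator false = 0

sumBelow : ℕ → (ℕ → ℕ) → ℕ
sumBelow zero    f = 0
sumBelow (suc n) f = sumBelow n f + f n

count : ℕ → (ℕ → Bool) → ℕ
count n P = sumBelow n (λ i → indicator (P i))

sum-cong : ∀ n {f g : ℕ → ℕ} → (∀ i → i < n → f i ≡ g i) → sumBelow n f ≡ sumBelow n g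
sum-cong zero    h = refl
sum-cong (suc n) h = cong₂ _+_ (sum-cong n (λ i i<n → h i (m<n⇒m<1+n i<n))) (h n ≤-refl)

sum-mono : ∀ n {f g : ℕ → ℕ} → (∀ i → i < n → f i ≤ g i) → sumBelow n f ≤ sumBelow n g
sum-mono zero    h = z≤n
sum-mono (suc n) h = +-mono-≤ (sum-mono n (λ i i<n → h i (m<n⇒m<1+n i<n))) (h n ≤-refl)

sum-+ : ∀ n (f g : ℕ → ℕ) → sumBelow n (λ i → f i + g i) ≡ sumBelow n f + sumBelow n g
sum-+ zero    f g = refl
sum-+ (suc n) f g rewrite sum-+ n f g = +-exchange (sumBelow n f) (sumBelow n g) (f n) (g n)
  where
  +-exchange : ∀ a b c d → a + b + (c + d) ≡ a + c + (b + d)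
  +-exchange = solve-∀

sum-*ˡ : ∀ n c (f : ℕ → ℕ) → sumBelow n (λ i → c * f i) ≡ c * sumBelow n f
sum-*ˡ zero    c f = sym (*-zeroʳ c)
sum-*ˡ (suc n) c f rewrite sum-*ˡ n c f = sym (*-distribˡ-+ c (sumBelow n f) (f n))

sum-*ʳ : ∀ n c (f : ℕ → ℕ) → sumBelow n (λ i → f i * c) ≡ sumBelow n f * c
sum-*ʳ zero    c f = refl
sum-*ʳ (suc n) c f rewrite sum-*ʳ n c f = sym (*-distribʳ-+ c (sumBelow n f) (f n))

sum-const : ∀ n c → sumBelow n (λ _ → c) ≡ n * c
sum-const zero    c = refl
sum-const (suc n) c rewrite sum-const n c = +-comm (n * c) c

sum-swap : ∀ n m (f : ℕ → ℕ → ℕ) →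
  sumBelow n (λ i → sumBelow m (f i)) ≡ sumBelow m (λ j → sumBelow n (λ i → f i j))
sum-swap zero    m f = sym (trans (sum-const m 0) (*-zeroʳ m))
sum-swap (suc n) m f rewrite sum-swap n m f = sym (sum-+ m (λ j → sumBelow n (λ i → f i j)) (f n))

sum-split : ∀ m l (f : ℕ → ℕ) → sumBelow (m + l) f ≡ sumBelow m f + sumBelow l (λ i → f (m + i))
sum-split m zero    f rewrite +-identityʳ m = sym (+-identityʳ (sumBelow m f))
sum-split m (suc l) f rewrite +-suc m l | sum-split m l f = +-assoc (sumBelow m f) _ _

sum-zero : ∀ n {f : ℕ → ℕ} → (∀ i → i < n → f i ≡ 0) → sumBelow n f ≡ 0
sum-zero n h = trans (sum-cong n h) (trans (sum-const n 0) (*-zeroʳ n))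

sum-single : ∀ x (f : ℕ → ℕ) k → k < x → (∀ i → i < x → i ≢ k → f i ≡ 0) → sumBelow x f ≡ f k
sum-single (suc x) f k k<1+x h with m≤n⇒m<n∨m≡n (s≤s⁻¹ k<1+x)
... | inj₁ k<x = trans (cong₂ _+_ (sum-single x f k k<x (λ i i<x → h i (m<n⇒m<1+n i<x)))
                                 (h x ≤-refl (≢-sym (<⇒≢ k<x))))
                       (+-identityʳ (f k))
... | inj₂ refl = cong (_+ f k) (sum-zero k (λ i i<k → h i (m<n⇒m<1+n i<k) (<⇒≢ i<k)))

+-tight : ∀ {a b a' b'} → a ≤ a' → b ≤ b' → a + b ≡ a' + b' → a ≡ a' × b ≡ b'
+-tight a≤a' b≤b' eq with m≤n⇒m<n∨m≡n a≤a' | m≤n⇒m<n∨m≡n b≤b'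
... | inj₂ e₁     | inj₂ e₂   = e₁ , e₂
... | inj₁ a<a'   | _         = ⊥-elim (<-irrefl eq (+-mono-<-≤ a<a' b≤b'))
... | inj₂ _      | inj₁ b<b' = ⊥-elim (<-irrefl eq (+-mono-≤-< a≤a' b<b'))

sum-allEqual : ∀ n (f : ℕ → ℕ) c → (∀ i → i < n → f i ≤ c) → sumBelow n f ≡ n * c →
  ∀ i → i < n → f i ≡ c
sum-allEqual (suc n) f c h total i i<1+n = go (m≤n⇒m<n∨m≡n (s≤s⁻¹ i<1+n))
  where
  h' : ∀ j → j < n → f j ≤ c
  h' j j<n = h j (m<n⇒m<1+n j<n)
  tight : sumBelow n f ≡ n * c × f n ≡ c
  tight = +-tight (≤-trans (sum-mono n h') (≤-reflexive (sum-const n c)))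
                  (h n ≤-refl) (trans total (+-comm c (n * c)))
  go : i < n ⊎ i ≡ n → f i ≡ c
  go (inj₁ i<n)  = sum-allEqual n f c h' (proj₁ tight) i i<n
  go (inj₂ refl) = proj₂ tight

infix 5 _∣ᵇ_
_∣ᵇ_ : ℕ → ℕ → Bool
d ∣ᵇ m = does (d ∣? m)

does-true⇒ : ∀ {A : Set} (a? : Dec A) → does a? ≡ true → A
does-true⇒ (yes a) _ = a

does-false⇒ : ∀ {A : Set} (a? : Dec A) → does a? ≡ false → ¬ A
does-false⇒ (no ¬a) _ = ¬a

≡ᵇ-true : ∀ m n → m ≡ n → (m ≡ᵇ n) ≡ true
≡ᵇ-true m n = dec-true (m ≟ n)

≡ᵇ-false : ∀ m n → m ≢ n → (m ≡ᵇ n) ≡ false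
≡ᵇ-false m n = dec-false (m ≟ n)

≡ᵇ-true⇒ : ∀ m n → (m ≡ᵇ n) ≡ true → m ≡ n
≡ᵇ-true⇒ m n = does-true⇒ (m ≟ n)

∧-true⇒ : ∀ {x y} → (x ∧ y) ≡ true → x ≡ true × y ≡ true
∧-true⇒ {true} {true} _ = refl , refl

∨-true⇒ : ∀ {x y} → (x ∨ y) ≡ true → x ≡ true ⊎ y ≡ true
∨-true⇒ {true}  _ = inj₁ refl
∨-true⇒ {false} h = inj₂ h

∧-true⇐ : ∀ {x y} → x ≡ true → y ≡ true → (x ∧ y) ≡ true
∧-true⇐ refl y≡true = y≡true

∨-trueˡ : ∀ {x y} → x ≡ true → (x ∨ y) ≡ true
∨-trueˡ refl = refl

∨-trueʳ : ∀ {x y} → y ≡ true → (x ∨ y) ≡ true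
∨-trueʳ {true}  _ = refl
∨-trueʳ {false} y≡true = y≡true

count-cong : ∀ n {P Q : ℕ → Bool} → (∀ i → i < n → P i ≡ Q i) → count n P ≡ count n Q
count-cong n h = sum-cong n (λ i i<n → cong indicator (h i i<n))

count-mono : ∀ n {P Q : ℕ → Bool} → (∀ i → i < n → P i ≡ true → Q i ≡ true) → count n P ≤ count n Q
count-mono n {P} {Q} h = sum-mono n termwise
  where
  termwise : ∀ i → i < n → indicator (P i) ≤ indicator (Q i)
  termwise i i<n with P i | h i i<n
  ... | true  | P⇒Q rewrite P⇒Q refl = ≤-refl
  ... | false | _ = z≤n

count-all : ∀ n {P : ℕ → Bool} → (∀ i → i < n → P i ≡ true) → count n P ≡ n
count-all n h = trans (sum-cong n (λ i i<n → cong indicator (h i i<n)))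
                      (trans (sum-const n 1) (*-identityʳ n))

count-+ : ∀ n (P Q R S : ℕ → Bool) →
  (∀ i → indicator (P i) + indicator (Q i) ≡ indicator (R i) + indicator (S i)) →
  count n P + count n Q ≡ count n R + count n S
count-+ n P Q R S h = begin
  count n P + count n Q                                ≡⟨ sum-+ n _ _ ⟨
  sumBelow n (λ i → indicator (P i) + indicator (Q i)) ≡⟨ sum-cong n (λ i _ → h i) ⟩
  sumBelow n (λ i → indicator (R i) + indicator (S i)) ≡⟨ sum-+ n _ _ ⟩
  count n R + count n S                                ∎
  where open ≡-Reasoning

count-∨ : ∀ n (P Q : ℕ → Bool) →
  count n (λ i → P i ∨ Q i) + count n (λ i → P i ∧ Q i) ≡ count n P + count n Q
count-∨ n P Q = count-+ n _ _ P Q (λ i → pointwise (P i) (Q i))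
  where
  pointwise : ∀ a b → indicator (a ∨ b) + indicator (a ∧ b) ≡ indicator a + indicator b
  pointwise true  true  = refl
  pointwise true  false = refl
  pointwise false b     = +-identityʳ (indicator b)

count-split : ∀ n (P Q : ℕ → Bool) →
  count n (λ i → P i ∧ Q i) + count n (λ i → P i ∧ not (Q i)) ≡ count n P
count-split n P Q = begin
  count n (λ i → P i ∧ Q i) + count n (λ i → P i ∧ not (Q i)) ≡⟨ count-+ n _ _ P _ (λ i → pointwise (P i) (Q i)) ⟩
  count n P + count n (λ _ → false)                            ≡⟨ cong (count n P +_) (sum-zero n (λ _ _ → refl)) ⟩
  count n P + 0                                                ≡⟨ +-identityʳ (count n P) ⟩
  count n P                                                    ∎
  where
  open ≡-Reasoning
  pointwise : ∀ a b → indicator (a ∧ b) + indicator (a ∧ not b) ≡ indicator a + 0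
  pointwise true  true  = refl
  pointwise true  false = refl
  pointwise false b     = refl

count-complement : ∀ n (P : ℕ → Bool) → count n P + count n (λ i → not (P i)) ≡ n
count-complement n P = trans (count-split n (λ _ → true) P) (count-all n (λ _ _ → refl))

count-layer : ∀ n (A D : ℕ → Bool) → (∀ i → A i ∧ D i ≡ D i) →
  count n (λ i → A i ∧ not (D i)) + count n D ≡ count n A
count-layer n A D D⇒A = begin
  count n (λ i → A i ∧ not (D i)) + count n D                  ≡⟨ cong (count n (λ i → A i ∧ not (D i)) +_) (count-cong n (λ i _ → D⇒A i)) ⟨
  count n (λ i → A i ∧ not (D i)) + count n (λ i → A i ∧ D i)  ≡⟨ +-comm _ (count n (λ i → A i ∧ D i)) ⟩
  count n (λ i → A i ∧ D i) + count n (λ i → A i ∧ not (D i))  ≡⟨ count-split n A D ⟩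
  count n A                                                    ∎
  where open ≡-Reasoning

count-atMostOne : ∀ n (P : ℕ → Bool) →
  (∀ b b' → b < n → b' < n → P b ≡ true → P b' ≡ true → b ≡ b') → count n P ≤ 1
count-atMostOne zero    P uniq = z≤n
count-atMostOne (suc n) P uniq with P n in Pn
... | true  = ≤-reflexive (cong (_+ 1) (sum-zero n vanish))
  where
  vanish : ∀ i → i < n → indicator (P i) ≡ 0
  vanish i i<n with P i in Pi
  ... | true  = ⊥-elim (<⇒≢ i<n (uniq i n (m<n⇒m<1+n i<n) ≤-refl Pi Pn))
  ... | false = refl
... | false = ≤-trans (≤-reflexive (+-identityʳ (count n P)))
                      (count-atMostOne n P (λ b b' b<n b'<n → uniq b b' (m<n⇒m<1+n b<n) (m<n⇒m<1+n b'<n)))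

count-exactlyOne : ∀ n (P : ℕ → Bool) b → b < n → P b ≡ true → (∀ i → i < n → P i ≡ true → i ≡ b) →
  count n P ≡ 1
count-exactlyOne n P b b<n Pb only = trans (sum-single n _ b b<n vanish) (cong indicator Pb)
  where
  vanish : ∀ i → i < n → i ≢ b → indicator (P i) ≡ 0
  vanish i i<n i≢b with P i in Pi
  ... | true  = ⊥-elim (i≢b (only i i<n Pi))
  ... | false = refl

count-multiples : ∀ D k .{{_ : NonZero D}} → count (D * k) (D ∣ᵇ_) ≡ k
count-multiples D zero rewrite *-zeroʳ D = refl
count-multiples D (suc k) = begin
  count (D * suc k) (D ∣ᵇ_)                                ≡⟨ cong (λ m → count m (D ∣ᵇ_)) (*-suc D k) ⟩
  count (D + D * k) (D ∣ᵇ_)                                ≡⟨ cong (λ m → count m (D ∣ᵇ_)) (+-comm D (D * k)) ⟩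
  count (D * k + D) (D ∣ᵇ_)                                ≡⟨ sum-split (D * k) D _ ⟩
  count (D * k) (D ∣ᵇ_) + count D (λ i → D ∣ᵇ (D * k + i)) ≡⟨ cong₂ _+_ (count-multiples D k) lastBlock ⟩
  k + 1                                                    ≡⟨ +-comm k 1 ⟩
  suc k                                                    ∎
  where
  open ≡-Reasoning
  -- within the block D·k, …, D·k + D - 1 only D·k itself is a multiple of D
  lastBlock : count D (λ i → D ∣ᵇ (D * k + i)) ≡ 1
  lastBlock = count-exactlyOne D _ 0 (>-nonZero⁻¹ D)
                (dec-true (D ∣? (D * k + 0)) (subst (D ∣_) (sym (+-identityʳ (D * k))) (m∣m*n k)))
                onlyZero
    where
    onlyZero : ∀ i → i < D → D ∣ᵇ (D * k + i) ≡ true → i ≡ 0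
    onlyZero zero    _   _ = refl
    onlyZero (suc i) i<D h = ⊥-elim (>⇒∤ i<D (∣m+n∣m⇒∣n (does-true⇒ (D ∣? _) h) (m∣m*n k)))

-- the same, for a range whose length equals D·k only propositionally
count-multiples≡ : ∀ D k x .{{_ : NonZero D}} → x ≡ D * k → count x (D ∣ᵇ_) ≡ k
count-multiples≡ D k x refl = count-multiples D k

-- Counting through residues: the Chinese remainder theorem in counting form.

sum-delta : ∀ x k (f : ℕ → ℕ) → k < x → sumBelow x (λ r → indicator (k ≡ᵇ r) * f r) ≡ f k
sum-delta x k f k<x = begin
  sumBelow x (λ r → indicator (k ≡ᵇ r) * f r) ≡⟨ sum-single x _ k k<x offDiagonal ⟩
  indicator (k ≡ᵇ k) * f k                   ≡⟨ cong (λ t → indicator t * f k) (≡ᵇ-true k k refl) ⟩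
  f k + 0                                    ≡⟨ +-identityʳ (f k) ⟩
  f k                                        ∎
  where
  open ≡-Reasoning
  offDiagonal : ∀ i → i < x → i ≢ k → indicator (k ≡ᵇ i) * f i ≡ 0
  offDiagonal i _ i≢k rewrite ≡ᵇ-false k i (≢-sym i≢k) = refl

indicator-∧ : ∀ a b → indicator (a ∧ b) ≡ indicator a * indicator b
indicator-∧ true  b = sym (+-identityʳ (indicator b))
indicator-∧ false b = refl

%-cong⇒∣∸ : ∀ x .{{_ : NonZero x}} b b' → b % x ≡ b' % x → x ∣ b' ∸ b
%-cong⇒∣∸ x b b' eq = divides (b' / x ∸ b / x) (begin
  b' ∸ b                                            ≡⟨ cong₂ _∸_ (m≡m%n+[m/n]*n b' x) (m≡m%n+[m/n]*n b x) ⟩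
  (b' % x + b' / x * x) ∸ (b % x + b / x * x)       ≡⟨ cong (λ r → (b' % x + b' / x * x) ∸ (r + b / x * x)) eq ⟩
  (b' % x + b' / x * x) ∸ (b' % x + b / x * x)      ≡⟨ [m+n]∸[m+o]≡n∸o (b' % x) _ _ ⟩
  b' / x * x ∸ b / x * x                            ≡⟨ *-distribʳ-∸ x (b' / x) (b / x) ⟨
  (b' / x ∸ b / x) * x                              ∎)
  where open ≡-Reasoning

coprime-∣⇒*∣ : ∀ {x y d} → Coprime x y → x ∣ d → y ∣ d → x * y ∣ d
coprime-∣⇒*∣ {x} {y} c x∣d (divides o refl) with coprime-divisor c (subst (x ∣_) (*-comm o y) x∣d)
... | divides o' refl = divides o' (*-assoc o' x y)

∣∧<⇒≡0 : ∀ {m d} → m ∣ d → d < m → d ≡ 0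
∣∧<⇒≡0 {d = zero}  _   _   = refl
∣∧<⇒≡0 {d = suc d} m∣d d<m = ⊥-elim (>⇒∤ d<m m∣d)

crt-unique : ∀ x y .{{_ : NonZero x}} .{{_ : NonZero y}} → Coprime x y → ∀ {b b'} → b < x * y → b' < x * y →
  b % x ≡ b' % x → b % y ≡ b' % y → b ≡ b'
crt-unique x y cop {b} {b'} b<xy b'<xy eqx eqy =
  ≤-antisym (m∸n≡0⇒m≤n (gap≡0 b<xy (sym eqx) (sym eqy))) (m∸n≡0⇒m≤n (gap≡0 b'<xy eqx eqy))
  where
  gap≡0 : ∀ {u v} → v < x * y → u % x ≡ v % x → u % y ≡ v % y → v ∸ u ≡ 0
  gap≡0 {u} {v} v<xy ex ey =
    ∣∧<⇒≡0 (coprime-∣⇒*∣ cop (%-cong⇒∣∸ x u v ex) (%-cong⇒∣∸ y u v ey)) (≤-<-trans (m∸n≤m v u) v<xy)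

-- Group b < xy by its residue pair (r, s); each group ("fibre") has at most one
-- element by uniqueness, and the xy elements fill the xy groups, so each has exactly one.
module ChineseCount (x y : ℕ) .{{_ : NonZero x}} .{{_ : NonZero y}} (cop : Coprime x y) where

  hasResidues : ℕ → ℕ → ℕ → Bool
  hasResidues r s b = (b % x ≡ᵇ r) ∧ (b % y ≡ᵇ s)

  fibre : ℕ → ℕ → ℕ
  fibre r s = count (x * y) (hasResidues r s)

  weight : (P Q : ℕ → Bool) → ℕ → ℕ → ℕ
  weight P Q r s = indicator (P r) * indicator (Q s)

  indicator-byResidues : ∀ (P Q : ℕ → Bool) b →
    indicator (P (b % x) ∧ Q (b % y)) ≡
    sumBelow x (λ r → sumBelow y (λ s → indicator (hasResidues r s b) * weight P Q r s))
  indicator-byResidues P Q b = sym (begin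
    sumBelow x (λ r → sumBelow y (λ s → indicator (hasResidues r s b) * weight P Q r s))
      ≡⟨ sum-cong x (λ r _ → sum-cong y (λ s _ → factor r s)) ⟩
    sumBelow x (λ r → sumBelow y (λ s → (δu r * indicator (P r)) * (δv s * indicator (Q s))))
      ≡⟨ sum-cong x (λ r _ → sum-*ˡ y (δu r * indicator (P r)) (λ s → δv s * indicator (Q s))) ⟩
    sumBelow x (λ r → (δu r * indicator (P r)) * sumBelow y (λ s → δv s * indicator (Q s)))
      ≡⟨ sum-cong x (λ r _ → cong ((δu r * indicator (P r)) *_) (sum-delta y v (indicator ∘ Q) (m%n<n b y))) ⟩
    sumBelow x (λ r → (δu r * indicator (P r)) * indicator (Q v))
      ≡⟨ sum-*ʳ x _ _ ⟩
    sumBelow x (λ r → δu r * indicator (P r)) * indicator (Q v)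
      ≡⟨ cong (_* indicator (Q v)) (sum-delta x u (indicator ∘ P) (m%n<n b x)) ⟩
    indicator (P u) * indicator (Q v)
      ≡⟨ indicator-∧ (P u) (Q v) ⟨
    indicator (P u ∧ Q v) ∎)
    where
    open ≡-Reasoning
    u = b % x
    v = b % y
    δu δv : ℕ → ℕ
    δu r = indicator (u ≡ᵇ r)
    δv s = indicator (v ≡ᵇ s)
    factor : ∀ r s → indicator (hasResidues r s b) * weight P Q r s ≡ (δu r * indicator (P r)) * (δv s * indicator (Q s))
    factor r s rewrite indicator-∧ (u ≡ᵇ r) (v ≡ᵇ s) = interchange (δu r) (δv s) (indicator (P r)) (indicator (Q s))
      where
      interchange : ∀ a b c d → a * b * (c * d) ≡ a * c * (b * d)
      interchange = solve-∀

  count-byResidues : ∀ (P Q : ℕ → Bool) →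
    count (x * y) (λ b → P (b % x) ∧ Q (b % y)) ≡ sumBelow x (λ r → sumBelow y (λ s → fibre r s * weight P Q r s))
  count-byResidues P Q = begin
    sumBelow (x * y) (λ b → indicator (P (b % x) ∧ Q (b % y)))
      ≡⟨ sum-cong (x * y) (λ b _ → indicator-byResidues P Q b) ⟩
    sumBelow (x * y) (λ b → sumBelow x (λ r → sumBelow y (λ s → term b r s)))
      ≡⟨ sum-swap (x * y) x _ ⟩
    sumBelow x (λ r → sumBelow (x * y) (λ b → sumBelow y (λ s → term b r s)))
      ≡⟨ sum-cong x (λ r _ → sum-swap (x * y) y _) ⟩
    sumBelow x (λ r → sumBelow y (λ s → sumBelow (x * y) (λ b → term b r s)))
      ≡⟨ sum-cong x (λ r _ → sum-cong y (λ s _ → sum-*ʳ (x * y) _ _)) ⟩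
    sumBelow x (λ r → sumBelow y (λ s → fibre r s * weight P Q r s)) ∎
    where
    open ≡-Reasoning
    term : ℕ → ℕ → ℕ → ℕ
    term b r s = indicator (hasResidues r s b) * weight P Q r s

  fibre≤1 : ∀ r s → fibre r s ≤ 1
  fibre≤1 r s = count-atMostOne (x * y) _ sameResidues
    where
    sameResidues : ∀ b b' → b < x * y → b' < x * y → hasResidues r s b ≡ true → hasResidues r s b' ≡ true → b ≡ b'
    sameResidues b b' b< b'< h h' with ∧-true⇒ h | ∧-true⇒ h'
    ... | hx , hy | hx' , hy' = crt-unique x y cop b< b'<
      (trans (≡ᵇ-true⇒ _ _ hx) (sym (≡ᵇ-true⇒ _ _ hx'))) (trans (≡ᵇ-true⇒ _ _ hy) (sym (≡ᵇ-true⇒ _ _ hy')))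

  fibres-total : sumBelow x (λ r → sumBelow y (fibre r)) ≡ x * y
  fibres-total = sym (begin
    x * y                                                  ≡⟨ count-all (x * y) (λ _ _ → refl) ⟨
    count (x * y) (λ b → true ∧ true)                      ≡⟨ count-byResidues (λ _ → true) (λ _ → true) ⟩
    sumBelow x (λ r → sumBelow y (λ s → fibre r s * 1))    ≡⟨ sum-cong x (λ r _ → sum-cong y (λ s _ → *-identityʳ (fibre r s))) ⟩
    sumBelow x (λ r → sumBelow y (fibre r))                ∎)
    where open ≡-Reasoning

  fibre≡1 : ∀ r s → r < x → s < y → fibre r s ≡ 1
  fibre≡1 r s r<x s<y = sum-allEqual y (fibre r) 1 (λ s _ → fibre≤1 r s) (trans row≡y (sym (*-identityʳ y))) s s<y
    where
    row≤y : ∀ r → r < x → sumBelow y (fibre r) ≤ y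
    row≤y r _ = ≤-trans (sum-mono y (λ s _ → fibre≤1 r s)) (≤-reflexive (trans (sum-const y 1) (*-identityʳ y)))
    row≡y : sumBelow y (fibre r) ≡ y
    row≡y = sum-allEqual x (λ r → sumBelow y (fibre r)) y row≤y fibres-total r r<x

  count-× : ∀ (P Q : ℕ → Bool) → count (x * y) (λ b → P (b % x) ∧ Q (b % y)) ≡ count x P * count y Q
  count-× P Q = begin
    count (x * y) (λ b → P (b % x) ∧ Q (b % y))                 ≡⟨ count-byResidues P Q ⟩
    sumBelow x (λ r → sumBelow y (λ s → fibre r s * weight P Q r s))
      ≡⟨ sum-cong x (λ r r<x → sum-cong y (λ s s<y → cong (_* weight P Q r s) (fibre≡1 r s r<x s<y))) ⟩
    sumBelow x (λ r → sumBelow y (λ s → 1 * weight P Q r s))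
      ≡⟨ sum-cong x (λ r _ → sum-cong y (λ s _ → *-identityˡ (weight P Q r s))) ⟩
    sumBelow x (λ r → sumBelow y (λ s → indicator (P r) * indicator (Q s)))
      ≡⟨ sum-cong x (λ r _ → sum-*ˡ y (indicator (P r)) (indicator ∘ Q)) ⟩
    sumBelow x (λ r → indicator (P r) * count y Q)             ≡⟨ sum-*ʳ x _ _ ⟩
    count x P * count y Q                                      ∎
    where open ≡-Reasoning

-- Adjacency in P(Cₙ) through gcds: b is a power of a exactly when gcd(a, n) ∣ b.

%-cong-* : ∀ {m m' k k'} n .{{_ : NonZero n}} → m % n ≡ m' % n → k % n ≡ k' % n → (m * k) % n ≡ (m' * k') % n
%-cong-* {m} {m'} {k} {k'} n eqm eqk = begin
  (m * k) % n                ≡⟨ %-distribˡ-* m k n ⟩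
  ((m % n) * (k % n)) % n    ≡⟨ cong₂ (λ u v → (u * v) % n) eqm eqk ⟩
  ((m' % n) * (k' % n)) % n  ≡⟨ %-distribˡ-* m' k' n ⟨
  (m' * k') % n              ∎
  where open ≡-Reasoning

bezout-multiple : ∀ n .{{_ : NonZero n}} a → ∃[ k ] (k * a) % n ≡ gcd a n % n
bezout-multiple n@(suc n') a with Bézout.identity (gcd-GCD a n)
... | Bézout.+- x y eq = x , (begin
  (x * a) % n          ≡⟨ cong (_% n) eq ⟨
  (g + y * n) % n      ≡⟨ [m+kn]%n≡m%n g y n ⟩
  g % n                ∎)
  where
  open ≡-Reasoning
  g = gcd a n
... | Bézout.-+ x y eq = x * n' , (begin
  (x * n' * a) % n             ≡⟨ [m+kn]%n≡m%n (x * n' * a) y n ⟨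
  (x * n' * a + y * n) % n     ≡⟨ cong (λ t → (x * n' * a + t) % n) eq ⟨
  (x * n' * a + (g + x * a)) % n ≡⟨ cong (_% n) (rearrange x n' a g) ⟩
  (g + (x * a) * n) % n        ≡⟨ [m+kn]%n≡m%n g (x * a) n ⟩
  g % n                        ∎)
  where
  open ≡-Reasoning
  g = gcd a n
  rearrange : ∀ x n' a g → x * n' * a + (g + x * a) ≡ g + (x * a) * suc n'
  rearrange = solve-∀

isPowerOf⇒gcd∣ : ∀ n .{{_ : NonZero n}} a b → isPowerOf n b a ≡ true → gcd a n ∣ b
isPowerOf⇒gcd∣ n a b h with find (any⁻ _ (upTo n) (Equivalence.from T-≡ h))
... | k , _ , k·a≡b = subst (gcd a n ∣_) (≡ᵇ⇒≡ _ _ k·a≡b)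
                        (%-presˡ-∣ (∣n⇒∣m*n k (gcd[m,n]∣m a n)) (gcd[m,n]∣n a n))

gcd∣⇒isPowerOf : ∀ n .{{_ : NonZero n}} a b → b < n → gcd a n ∣ b → isPowerOf n b a ≡ true
gcd∣⇒isPowerOf n a b b<n (divides t refl) with bezout-multiple n a
... | k , k·a≡g = Equivalence.to T-≡ (any⁺ _ (lose (∈-upTo⁺ (m%n<n (k * t) n)) (≡⇒≡ᵇ _ _ hits)))
  where
  open ≡-Reasoning
  hits : ((k * t) % n * a) % n ≡ t * gcd a n
  hits = begin
    ((k * t) % n * a) % n   ≡⟨ %-cong-* n (m%n%n≡m%n (k * t) n) refl ⟩
    (k * t * a) % n         ≡⟨ cong (_% n) (rearrange k t a) ⟩
    (t * (k * a)) % n       ≡⟨ %-cong-* {t} {t} n refl k·a≡g ⟩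
    (t * gcd a n) % n       ≡⟨ m<n⇒m%n≡m b<n ⟩
    t * gcd a n             ∎
    where
    rearrange : ∀ k t a → k * t * a ≡ t * (k * a)
    rearrange = solve-∀

isPowerOf≡gcd∣ᵇ : ∀ n .{{_ : NonZero n}} a b → b < n → isPowerOf n b a ≡ gcd a n ∣ᵇ b
isPowerOf≡gcd∣ᵇ n a b b<n with gcd a n ∣? b | isPowerOf n b a in isPow
... | yes g∣b | _     = trans (sym isPow) (gcd∣⇒isPowerOf n a b b<n g∣b)
... | no  _   | false = refl
... | no  g∤b | true  = ⊥-elim (g∤b (isPowerOf⇒gcd∣ n a b isPow))

closedAdjacent : ℕ → ℕ → ℕ → Bool
closedAdjacent n a b = (gcd a n ∣ᵇ b) ∨ (gcd b n ∣ᵇ a)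

length-filter-upTo : ∀ (P : ℕ → Bool) n → length (filter (λ b → T? (P b)) (upTo n)) ≡ count n P
length-filter-upTo P zero    = refl
length-filter-upTo P (suc n) = begin
  length (filter P? (upTo (suc n)))                 ≡⟨ cong (length ∘ filter P?) (upTo-∷ʳ n) ⟨
  length (filter P? (upTo n ++ [ n ]))              ≡⟨ cong length (filter-++ P? (upTo n) [ n ]) ⟩
  length (filter P? (upTo n) ++ filter P? [ n ])    ≡⟨ length-++ (filter P? (upTo n)) ⟩
  length (filter P? (upTo n)) + length (filter P? [ n ]) ≡⟨ cong₂ _+_ (length-filter-upTo P n) last ⟩
  count n P + indicator (P n)                       ∎
  where
  open ≡-Reasoning
  P? = λ b → T? (P b)
  last : length (filter P? [ n ]) ≡ indicator (P n)
  last with P n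
  ... | true  = refl
  ... | false = refl

deg+1 : ∀ n .{{_ : NonZero n}} a → a < n → deg n a + 1 ≡ count n (closedAdjacent n a)
deg+1 n a a<n = begin
  deg n a + 1                                                         ≡⟨ cong₂ _+_ degAsCount (sym onlySelf) ⟩
  count n (λ b → N b ∧ not (a ≡ᵇ b)) + count n (λ b → N b ∧ (a ≡ᵇ b)) ≡⟨ +-comm _ (count n (λ b → N b ∧ (a ≡ᵇ b))) ⟩
  count n (λ b → N b ∧ (a ≡ᵇ b)) + count n (λ b → N b ∧ not (a ≡ᵇ b)) ≡⟨ count-split n N (a ≡ᵇ_) ⟩
  count n N                                                           ∎
  where
  open ≡-Reasoning
  N = closedAdjacent n a
  degAsCount : deg n a ≡ count n (λ b → N b ∧ not (a ≡ᵇ b))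
  degAsCount = trans (length-filter-upTo (adjacent n a) n) (count-cong n (λ b b<n → begin
    not (a ≡ᵇ b) ∧ (isPowerOf n b a ∨ isPowerOf n a b)
      ≡⟨ cong₂ (λ u v → not (a ≡ᵇ b) ∧ (u ∨ v)) (isPowerOf≡gcd∣ᵇ n a b b<n) (isPowerOf≡gcd∣ᵇ n b a a<n) ⟩
    not (a ≡ᵇ b) ∧ N b ≡⟨ ∧-comm (not (a ≡ᵇ b)) (N b) ⟩
    N b ∧ not (a ≡ᵇ b) ∎))
  onlySelf : count n (λ b → N b ∧ (a ≡ᵇ b)) ≡ 1
  onlySelf = count-exactlyOne n _ a a<n self only
    where
    self : N a ∧ (a ≡ᵇ a) ≡ true
    self rewrite dec-true (gcd a n ∣? a) (gcd[m,n]∣m a n) | ≡ᵇ-true a a refl = refl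
    only : ∀ b → b < n → N b ∧ (a ≡ᵇ b) ≡ true → b ≡ a
    only b _ h = sym (≡ᵇ-true⇒ a b (proj₂ (∧-true⇒ h)))

prime≥2 : ∀ {p} → Prime p → 2 ≤ p
prime≥2 {p} pp = nonTrivial⇒n>1 p {{prime⇒nonTrivial pp}}

prime∤1 : ∀ {p} → Prime p → ¬ p ∣ 1
prime∤1 pp p∣1 = <⇒≢ (prime≥2 pp) (sym (∣1⇒≡1 p∣1))

prime∣pow⇒≡ : ∀ {p q} e → Prime p → Prime q → p ∣ q ^ e → p ≡ q
prime∣pow⇒≡ zero    pp pq p∣1 = ⊥-elim (prime∤1 pp p∣1)
prime∣pow⇒≡ {p} {q} (suc e) pp pq p∣q^[1+e] with euclidsLemma q (q ^ e) pp p∣q^[1+e]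
... | inj₂ p∣q^e = prime∣pow⇒≡ e pp pq p∣q^e
... | inj₁ p∣q with prime⇒irreducible pq p∣q
...   | inj₁ refl = ⊥-elim (prime∤1 pp ∣-refl)
...   | inj₂ p≡q  = p≡q

prime∤pow*pow : ∀ {p q r} e f → Prime p → Prime q → Prime r → p ≢ q → p ≢ r → ¬ p ∣ q ^ e * r ^ f
prime∤pow*pow e f pp pq pr p≢q p≢r h with euclidsLemma _ _ pp h
... | inj₁ p∣q^e = p≢q (prime∣pow⇒≡ e pp pq p∣q^e)
... | inj₂ p∣r^f = p≢r (prime∣pow⇒≡ f pp pr p∣r^f)

split-divisor : ∀ {p r d} α → Prime p → ¬ p ∣ r → d ∣ p ^ α * r →
  ∃[ e ] ∃[ d' ] (e ≤ α × d ≡ p ^ e * d' × d' ∣ r)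
split-divisor {p} {r} {d} α pp p∤r d∣ with p ∣? d
... | no p∤d = 0 , d , z≤n , sym (+-identityʳ d) , strip α d∣
  where
  -- p^α is coprime to d, so it can be cancelled
  strip : ∀ α → d ∣ p ^ α * r → d ∣ r
  strip zero    h = subst (d ∣_) (+-identityʳ r) h
  strip (suc α) h = strip α (coprime-divisor d⊥p (subst (d ∣_) (*-assoc p (p ^ α) r) h))
    where
    d⊥p : Coprime d p
    d⊥p (c∣d , c∣p) with prime⇒irreducible pp c∣p
    ... | inj₁ c≡1  = c≡1
    ... | inj₂ refl = ⊥-elim (p∤d c∣d)
split-divisor {p} {r} zero pp p∤r d∣ | yes (divides q refl) =
  ⊥-elim (p∤r (∣-trans (n∣m*n q) (subst (q * p ∣_) (+-identityʳ r) d∣)))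
split-divisor {p} {r} (suc α) pp p∤r d∣ | yes (divides q refl)
  with split-divisor α pp p∤r (*-cancelˡ-∣ p {{prime⇒nonZero pp}} (subst₂ _∣_ (*-comm q p) (*-assoc p (p ^ α) r) d∣))
... | e , d' , e≤α , refl , d'∣r = suc e , d' , s≤s e≤α , rearrange (p ^ e) d' p , d'∣r
  where
  rearrange : ∀ a b c → a * b * c ≡ c * a * b
  rearrange = solve-∀

coprime-pow : ∀ {p m} e → Prime p → ¬ p ∣ m → Coprime (p ^ e) m
coprime-pow {p} {m} e pp p∤m {c} (c∣p^e , c∣m)
  with split-divisor e pp (prime∤1 pp) (subst (c ∣_) (sym (*-identityʳ (p ^ e))) c∣p^e)
... | zero   , d' , _ , refl , d'∣1 = trans (+-identityʳ d') (∣1⇒≡1 d'∣1)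
... | suc e' , d' , _ , refl , _    = ⊥-elim (p∤m (∣-trans (∣m⇒∣m*n d' (m∣m*n (p ^ e'))) c∣m))

pow-∣ : ∀ p {e h} → e ≤ h → p ^ e ∣ p ^ h
pow-∣ p {zero}  {h}     _         = 1∣ (p ^ h)
pow-∣ p {suc e} {suc h} (s≤s e≤h) = *-monoʳ-∣ p (pow-∣ p e≤h)

divisor-of-three-powers : ∀ {p₁ p₂ p₃ α₁ α₂ α₃ d} → Prime p₁ → Prime p₂ → Prime p₃ →
  p₁ ≢ p₂ → p₁ ≢ p₃ → p₂ ≢ p₃ → d ∣ p₁ ^ α₁ * p₂ ^ α₂ * p₃ ^ α₃ →
  ∃[ e₁ ] ∃[ e₂ ] ∃[ e₃ ] (e₁ ≤ α₁ × e₂ ≤ α₂ × e₃ ≤ α₃ × d ≡ p₁ ^ e₁ * p₂ ^ e₂ * p₃ ^ e₃)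
divisor-of-three-powers {p₁} {p₂} {p₃} {α₁} {α₂} {α₃} {d} pp₁ pp₂ pp₃ p₁≢p₂ p₁≢p₃ p₂≢p₃ d∣
  with split-divisor α₁ pp₁ (prime∤pow*pow α₂ α₃ pp₁ pp₂ pp₃ p₁≢p₂ p₁≢p₃) (subst (d ∣_) (*-assoc (p₁ ^ α₁) _ _) d∣)
... | e₁ , d₁ , e₁≤ , refl , d₁∣
  with split-divisor α₂ pp₂ (λ h → p₂≢p₃ (prime∣pow⇒≡ α₃ pp₂ pp₃ h)) d₁∣
... | e₂ , d₂ , e₂≤ , refl , d₂∣
  with split-divisor α₃ pp₃ (prime∤1 pp₃) (subst (d₂ ∣_) (sym (*-identityʳ (p₃ ^ α₃))) d₂∣)
... | e₃ , d₃ , e₃≤ , refl , d₃∣1 with ∣1⇒≡1 d₃∣1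
... | refl = e₁ , e₂ , e₃ , e₁≤ , e₂≤ , e₃≤ , rearrange (p₁ ^ e₁) (p₂ ^ e₂) (p₃ ^ e₃)
  where
  rearrange : ∀ a b c → a * (b * (c * 1)) ≡ a * b * c
  rearrange = solve-∀

-- Local counts at a single prime p, for the residues modulo p^α.

-- For a residue r modulo p^α and a local exponent e ≤ α:
--   atLeast p e r  : p^e ∣ r                    (v_p(r) ≥ e)
--   atMost p α e r : e = α or p^(e+1) ∤ r       (v_p(r) ≤ e, where v_p(0) is read as α)
atLeast : ℕ → ℕ → ℕ → Bool
atLeast p e r = p ^ e ∣ᵇ r

atMost : ℕ → ℕ → ℕ → ℕ → Bool
atMost p α e r = (α ≡ᵇ e) ∨ not (p ^ suc e ∣ᵇ r)

atLeast⇒∣ : ∀ p α e b .{{_ : NonZero (p ^ α)}} → e ≤ α → atLeast p e (b % p ^ α) ≡ true → p ^ e ∣ b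
atLeast⇒∣ p α e b e≤α h = ∣n∣m%n⇒∣m (pow-∣ p e≤α) (does-true⇒ (p ^ e ∣? _) h)

∣⇒atLeast : ∀ p α b .{{_ : NonZero (p ^ α)}} → p ^ α ∣ b → atLeast p α (b % p ^ α) ≡ true
∣⇒atLeast p α b p^α∣b = dec-true (p ^ α ∣? _) (%-presˡ-∣ p^α∣b ∣-refl)

atMost⇒≤ : ∀ p α e h b .{{_ : NonZero (p ^ α)}} → atMost p α e (b % p ^ α) ≡ true → h ≤ α → p ^ h ∣ b → h ≤ e
atMost⇒≤ p α e h b t h≤α p^h∣b with ∨-true⇒ {α ≡ᵇ e} t
... | inj₁ α≡e = subst (h ≤_) (≡ᵇ-true⇒ α e α≡e) h≤α
... | inj₂ notDeeper with h ≤? e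
...   | yes h≤e = h≤e
...   | no  h≰e = ⊥-elim (does-false⇒ (p ^ suc e ∣? _) (not-injective notDeeper) p^[1+e]∣b%x)
  where
  not-injective : ∀ {x} → not x ≡ true → x ≡ false
  not-injective {false} _ = refl
  1+e≤h : suc e ≤ h
  1+e≤h = ≰⇒> h≰e
  p^[1+e]∣b%x : p ^ suc e ∣ b % p ^ α
  p^[1+e]∣b%x = %-presˡ-∣ (∣-trans (pow-∣ p 1+e≤h) p^h∣b) (pow-∣ p (≤-trans 1+e≤h h≤α))

atMost-below : ∀ p α e r → e < α → atMost p α e r ≡ not (p ^ suc e ∣ᵇ r)
atMost-below p α e r e<α rewrite ≡ᵇ-false α e (λ α≡e → <-irrefl (sym α≡e) e<α) = refl

deeper⇒atLeast : ∀ p e r → atLeast p e r ∧ (p ^ suc e ∣ᵇ r) ≡ (p ^ suc e ∣ᵇ r)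
deeper⇒atLeast p e r with p ^ suc e ∣? r
... | yes p^[1+e]∣r = trans (∧-identityʳ _) (dec-true (p ^ e ∣? r) (∣-trans (pow-∣ p (n≤1+n e)) p^[1+e]∣r))
... | no  _         = ∧-zeroʳ _

-- The possible shapes of the local counts (a, b, c) = (#only atMost, #only atLeast, #both)
-- among the residues modulo p^α = p · β.
data Profile (p : ℕ) : (β a b c : ℕ) → Set where
  -- e < α, with s = p^(α-e-1) and d + s = β
  partial : ∀ d s → 1 ≤ s → Profile p (d + s) (p * d) s (pred p * s)
  -- e = α: only 0 is a multiple of p^α, and every residue satisfies atMost
  full    : ∀ β → 1 ≤ β → Profile p β (pred (p * β)) 0 1

record LocalCounts (p α e : ℕ) : Set where
  field
    β a b c  : ℕ
    profile  : Profile p β a b c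
    size     : p ^ α ≡ p * β
    #atMost  : count (p ^ α) (atMost p α e) ≡ a + c
    #atLeast : count (p ^ α) (atLeast p e) ≡ b + c
    #both    : count (p ^ α) (λ r → atLeast p e r ∧ atMost p α e r) ≡ c

localCounts-top : ∀ q α → LocalCounts (suc q) (suc α) (suc α)
localCounts-top q α = record
  { profile  = full β (m^n>0 p α)
  ; size     = refl
  ; #atMost  = trans (count-all x (λ r _ → top r)) (trans (sym (suc-pred x)) (+-comm 1 _))
  ; #atLeast = #atLeast
  ; #both    = trans (count-cong x (λ r _ → cong (atLeast p (suc α) r ∧_) (top r)))
                     (trans (count-cong x (λ r _ → ∧-identityʳ (atLeast p (suc α) r))) #atLeast)
  }
  where
  p = suc q
  β = p ^ α
  x = p ^ suc α
  instance
    x≢0 : NonZero x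
    x≢0 = m^n≢0 p (suc α)
  top : ∀ r → atMost p (suc α) (suc α) r ≡ true
  top r rewrite ≡ᵇ-true α α refl = refl
  #atLeast : count x (atLeast p (suc α)) ≡ 1
  #atLeast = count-multiples≡ x 1 x (sym (*-identityʳ x))

-- e < α, writing α = e + 1 + k: atLeast has p^(k+1) elements, of which p^k are multiples of p^(e+1)
localCounts-below : ∀ q e k → LocalCounts (suc q) (e + suc k) e
localCounts-below q e k = record
  { profile  = partial d s (m^n>0 p k)
  ; size     = x≡p[d+s]
  ; #atMost  = #atMost
  ; #atLeast = #atLeast
  ; #both    = #both
  }
  where
  open ≡-Reasoning
  p = suc q
  s = p ^ k
  d = pred (p ^ e) * s
  x = p ^ (e + suc k)
  instance
    x≢0 : NonZero x
    x≢0 = m^n≢0 p (e + suc k)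
    p^e≢0 : NonZero (p ^ e)
    p^e≢0 = m^n≢0 p e
    p^[1+e]≢0 : NonZero (p ^ suc e)
    p^[1+e]≢0 = m^n≢0 p (suc e)
  D : ℕ → Bool
  D r = p ^ suc e ∣ᵇ r
  atMost≡¬D : ∀ r → atMost p (e + suc k) e r ≡ not (D r)
  atMost≡¬D r = atMost-below p (e + suc k) e r (m<m+n e (s≤s z≤n))
  x≡p^e[ps] : x ≡ p ^ e * (p * s)
  x≡p^e[ps] = ^-distribˡ-+-* p e (suc k)
  x≡p^[1+e]s : x ≡ p ^ suc e * s
  x≡p^[1+e]s = trans (cong (p ^_) (+-suc e k)) (^-distribˡ-+-* p (suc e) k)
  x≡p[d+s] : x ≡ p * (d + s)
  x≡p[d+s] = begin
    x                              ≡⟨ x≡p^e[ps] ⟩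
    p ^ e * (p * s)                ≡⟨ *-exchange (p ^ e) p s ⟩
    p * (p ^ e * s)                ≡⟨ cong (λ t → p * (t * s)) (suc-pred (p ^ e)) ⟨
    p * (suc (pred (p ^ e)) * s)   ≡⟨ cong (p *_) (+-comm s d) ⟩
    p * (d + s)                    ∎
    where
    *-exchange : ∀ a b c → a * (b * c) ≡ b * (a * c)
    *-exchange = solve-∀
  #atLeast : count x (atLeast p e) ≡ s + q * s
  #atLeast = count-multiples≡ (p ^ e) (p * s) x x≡p^e[ps]
  #D : count x D ≡ s
  #D = count-multiples≡ (p ^ suc e) s x x≡p^[1+e]s
  #both : count x (λ r → atLeast p e r ∧ atMost p (e + suc k) e r) ≡ q * s
  #both = +-cancelʳ-≡ s _ _ (begin
    count x (λ r → atLeast p e r ∧ atMost p (e + suc k) e r) + s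
      ≡⟨ cong₂ _+_ (count-cong x (λ r _ → cong (atLeast p e r ∧_) (atMost≡¬D r))) (sym #D) ⟩
    count x (λ r → atLeast p e r ∧ not (D r)) + count x D
      ≡⟨ count-layer x (atLeast p e) D (deeper⇒atLeast p e) ⟩
    count x (atLeast p e)  ≡⟨ #atLeast ⟩
    s + q * s              ≡⟨ +-comm s (q * s) ⟩
    q * s + s              ∎)
  #atMost : count x (atMost p (e + suc k) e) ≡ p * d + q * s
  #atMost = +-cancelˡ-≡ s _ _ (begin
    s + count x (atMost p (e + suc k) e)       ≡⟨ cong₂ _+_ (sym #D) (count-cong x (λ r _ → atMost≡¬D r)) ⟩
    count x D + count x (λ r → not (D r))      ≡⟨ count-complement x D ⟩
    x                                          ≡⟨ x≡p[d+s] ⟩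
    suc q * (d + s)                            ≡⟨ regroup q d s ⟩
    s + (p * d + q * s)                        ∎)
    where
    regroup : ∀ q d s → suc q * (d + s) ≡ s + (suc q * d + q * s)
    regroup = solve-∀

localCounts : ∀ p α e .{{_ : NonZero p}} → e ≤ α → 1 ≤ α → LocalCounts p α e
localCounts (suc q) α e e≤α 1≤α with m≤n⇒m<n∨m≡n e≤α
... | inj₁ e<α with m≤n⇒∃[o]m+o≡n e<α
...   | k , refl = subst (λ α → LocalCounts (suc q) α e) (+-suc e k) (localCounts-below q e k)
localCounts (suc q) (suc α) .(suc α) _ _ | inj₂ refl = localCounts-top q α

profile-total : ∀ {p β a b c} .{{_ : NonZero p}} → Profile p β a b c → a + b + c ≡ p * β
profile-total {suc q} (partial d s _)  = total q d s
  where
  total : ∀ q d s → suc q * d + s + q * s ≡ suc q * (d + s)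
  total = solve-∀
profile-total {suc q} (full (suc u) _) = total q u
  where
  total : ∀ q u → u + q * suc u + 0 + 1 ≡ suc q * suc u
  total = solve-∀

profile-c≥1 : ∀ {p β a b c} → 2 ≤ p → Profile p β a b c → 1 ≤ c
profile-c≥1 2≤p (partial d s 1≤s) = *-mono-≤ (pred-mono-≤ 2≤p) 1≤s
profile-c≥1 2≤p (full β _)        = ≤-refl

profile-β≥1 : ∀ {p β a b c} → Profile p β a b c → 1 ≤ β
profile-β≥1 (partial d s 1≤s) = ≤-trans 1≤s (m≤n+m s d)
profile-β≥1 (full β 1≤β)      = 1≤β

profile-b≤β : ∀ {p β a b c} → Profile p β a b c → b ≤ β
profile-b≤β (partial d s _) = m≤n+m s d
profile-b≤β (full β _)      = z≤n

profile-a≡0 : ∀ {q β a b c} → 1 ≤ q → Profile (suc q) β a b c → a ≡ 0 → b ≡ β × c ≡ q * β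
profile-a≡0 {q} 1≤q (partial d s _) [1+q]d≡0 with m+n≡0⇒m≡0 d [1+q]d≡0
... | refl = refl , refl
profile-a≡0 {q} 1≤q (full (suc u) _) a≡0 =
  ⊥-elim (<⇒≢ (*-mono-≤ 1≤q (s≤s z≤n)) (sym (m+n≡0⇒n≡0 u a≡0)))

dMass sMass : ∀ {p β a b c} → Profile p β a b c → ℕ
dMass (partial d s _) = d
dMass (full β _)      = β
sMass (partial d s _) = s
sMass (full β _)      = 0

mass-total : ∀ {p β a b c} (π : Profile p β a b c) → dMass π + sMass π ≡ β
mass-total (partial d s _) = refl
mass-total (full β _)      = +-identityʳ β

β-unique : ∀ {p α e e'} .{{_ : NonZero p}} (L : LocalCounts p α e) (L' : LocalCounts p α e') →
  LocalCounts.β L ≡ LocalCounts.β L'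
β-unique {p} L L' = *-cancelˡ-≡ _ _ p (trans (sym (LocalCounts.size L)) (LocalCounts.size L'))

-- At e = 0 every residue satisfies atLeast, so nothing satisfies atMost alone:
-- the triple is (0, β, (p - 1)β).
localCounts-bottom : ∀ {p α} .{{_ : NonZero p}} → 2 ≤ p → (L : LocalCounts p α 0) →
  LocalCounts.a L ≡ 0 × LocalCounts.b L ≡ LocalCounts.β L × LocalCounts.c L ≡ pred p * LocalCounts.β L
localCounts-bottom {suc q} {α} 2≤p L = a≡0 , profile-a≡0 (s≤s⁻¹ 2≤p) profile a≡0
  where
  open LocalCounts L
  b+c≡x : b + c ≡ suc q ^ α
  b+c≡x = trans (sym #atLeast) (count-all (suc q ^ α) (λ r _ → dec-true (1 ∣? r) (1∣ r)))
  a≡0 : a ≡ 0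
  a≡0 = +-cancelʳ-≡ (b + c) a 0 (begin
    a + (b + c)   ≡⟨ +-assoc a b c ⟨
    a + b + c     ≡⟨ profile-total profile ⟩
    suc q * β     ≡⟨ size ⟨
    suc q ^ α     ≡⟨ b+c≡x ⟨
    b + c         ∎)
    where open ≡-Reasoning

-- At e = α only 0 satisfies atLeast, and everything satisfies atMost:
-- the triple is (p^α - 1, 0, 1).
localCounts-top-values : ∀ {p α} .{{_ : NonZero p}} → (L : LocalCounts p α α) →
  suc (LocalCounts.a L) ≡ p * LocalCounts.β L × LocalCounts.b L ≡ 0 × LocalCounts.c L ≡ 1
localCounts-top-values {p} {α} L = suc-a≡pβ , b≡0 , c≡1
  where
  open LocalCounts L
  instance
    x≢0 : NonZero (p ^ α)
    x≢0 = m^n≢0 p α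
  everything : ∀ r → atMost p α α r ≡ true
  everything r rewrite ≡ᵇ-true α α refl = refl
  b+c≡c : b + c ≡ 0 + c
  b+c≡c = trans (sym #atLeast)
                (trans (count-cong (p ^ α) (λ r _ → trans (sym (∧-identityʳ _)) (cong (atLeast p α r ∧_) (sym (everything r)))))
                       #both)
  b≡0 : b ≡ 0
  b≡0 = +-cancelʳ-≡ c b 0 b+c≡c
  c≡1 : c ≡ 1
  c≡1 = trans (sym (cong (_+ c) b≡0)) (trans (sym #atLeast)
              (count-multiples≡ (p ^ α) 1 (p ^ α) (sym (*-identityʳ (p ^ α)))))
  suc-a≡pβ : suc a ≡ p * β
  suc-a≡pβ = begin
    suc a              ≡⟨ +-comm 1 a ⟩
    a + 1              ≡⟨ cong (a +_) c≡1 ⟨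
    a + c              ≡⟨ #atMost ⟨
    count (p ^ α) (atMost p α α) ≡⟨ count-all (p ^ α) (λ r _ → everything r) ⟩
    p ^ α              ≡⟨ size ⟩
    p * β              ∎
    where open ≡-Reasoning

-- The cross term of three local triples and the central estimate.

-- For local triples (aᵢ, bᵢ, cᵢ) with aᵢ + bᵢ + cᵢ = xᵢ, the cross term K satisfies
--   Π(aᵢ + cᵢ) + Π(bᵢ + cᵢ) + K = Π xᵢ + Π cᵢ,
-- so the union of the two product sets has Π xᵢ - K elements.
crossTerm : (a₁ b₁ c₁ a₂ b₂ c₂ a₃ b₃ c₃ : ℕ) → ℕ
crossTerm a₁ b₁ c₁ a₂ b₂ c₂ a₃ b₃ c₃ =
  (a₁ * b₂ + b₁ * a₂) * (a₃ + b₃ + c₃) + (a₁ * a₂ + a₁ * c₂ + c₁ * a₂) * b₃ + (b₁ * b₂ + b₁ * c₂ + c₁ * b₂) * a₃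

crossTerm-identity : ∀ a₁ b₁ c₁ a₂ b₂ c₂ a₃ b₃ c₃ →
  (a₁ + c₁) * (a₂ + c₂) * (a₃ + c₃) + (b₁ + c₁) * (b₂ + c₂) * (b₃ + c₃) + crossTerm a₁ b₁ c₁ a₂ b₂ c₂ a₃ b₃ c₃
  ≡ (a₁ + b₁ + c₁) * (a₂ + b₂ + c₂) * (a₃ + b₃ + c₃) + c₁ * c₂ * c₃
crossTerm-identity = identity
  where
  identity : ∀ a₁ b₁ c₁ a₂ b₂ c₂ a₃ b₃ c₃ →
    (a₁ + c₁) * (a₂ + c₂) * (a₃ + c₃) + (b₁ + c₁) * (b₂ + c₂) * (b₃ + c₃) +
    ((a₁ * b₂ + b₁ * a₂) * (a₃ + b₃ + c₃) + (a₁ * a₂ + a₁ * c₂ + c₁ * a₂) * b₃ + (b₁ * b₂ + b₁ * c₂ + c₁ * b₂) * a₃)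
    ≡ (a₁ + b₁ + c₁) * (a₂ + b₂ + c₂) * (a₃ + b₃ + c₃) + c₁ * c₂ * c₃
  identity = solve-∀

-- the third triple enters only through a₃ + b₃ + c₃ = Z + 1, a₃ ≤ Z and b₃ ≤ B
reducedCross : (Z B a₁ b₁ c₁ a₂ b₂ c₂ : ℕ) → ℕ
reducedCross Z B a₁ b₁ c₁ a₂ b₂ c₂ =
  (a₁ * b₂ + b₁ * a₂) * suc Z + (a₁ * a₂ + a₁ * c₂ + c₁ * a₂) * B + (b₁ * b₂ + b₁ * c₂ + c₁ * b₂) * Z

crossTerm≤reduced : ∀ {Z B a₁ b₁ c₁ a₂ b₂ c₂ a₃ b₃ c₃} → a₃ + b₃ + c₃ ≡ suc Z → 1 ≤ c₃ → b₃ ≤ B →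
  crossTerm a₁ b₁ c₁ a₂ b₂ c₂ a₃ b₃ c₃ ≤ reducedCross Z B a₁ b₁ c₁ a₂ b₂ c₂
crossTerm≤reduced {Z} {B} {a₁} {b₁} {c₁} {a₂} {b₂} {c₂} {a₃} {b₃} {c₃} sum 1≤c₃ b₃≤B rewrite sum =
  +-mono-≤ (+-monoʳ-≤ ((a₁ * b₂ + b₁ * a₂) * suc Z) (*-monoʳ-≤ (a₁ * a₂ + a₁ * c₂ + c₁ * a₂) b₃≤B))
           (*-monoʳ-≤ (b₁ * b₂ + b₁ * c₂ + c₁ * b₂) a₃≤Z)
  where
  a₃≤Z : a₃ ≤ Z
  a₃≤Z = s≤s⁻¹ (begin
    suc a₃            ≡⟨ +-comm 1 a₃ ⟩
    a₃ + 1            ≤⟨ +-monoʳ-≤ a₃ (≤-trans 1≤c₃ (m≤n+m c₃ b₃)) ⟩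
    a₃ + (b₃ + c₃)    ≡⟨ +-assoc a₃ b₃ c₃ ⟨
    a₃ + b₃ + c₃      ≡⟨ sum ⟩
    suc Z             ∎)
    where open ≤-Reasoning

massForm : (E₁ E₂ E₃ F d₁ s₁ d₂ s₂ : ℕ) → ℕ
massForm E₁ E₂ E₃ F d₁ s₁ d₂ s₂ = d₁ * s₂ * E₁ + s₁ * d₂ * E₂ + d₁ * d₂ * E₃ + s₁ * s₂ * F

massForm-bound : ∀ {E₁ E₂ E₃ F} d₁ s₁ d₂ s₂ → E₁ ≤ F → E₂ ≤ F → E₃ ≤ F →
  massForm E₁ E₂ E₃ F d₁ s₁ d₂ s₂ ≤ (d₁ + s₁) * (d₂ + s₂) * F
massForm-bound {F = F} d₁ s₁ d₂ s₂ E₁≤F E₂≤F E₃≤F = begin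
  d₁ * s₂ * _ + s₁ * d₂ * _ + d₁ * d₂ * _ + s₁ * s₂ * F
    ≤⟨ +-monoˡ-≤ (s₁ * s₂ * F) (+-mono-≤ (+-mono-≤ (*-monoʳ-≤ (d₁ * s₂) E₁≤F) (*-monoʳ-≤ (s₁ * d₂) E₂≤F))
                                         (*-monoʳ-≤ (d₁ * d₂) E₃≤F)) ⟩
  d₁ * s₂ * F + s₁ * d₂ * F + d₁ * d₂ * F + s₁ * s₂ * F
    ≡⟨ expand d₁ s₁ d₂ s₂ F ⟨
  (d₁ + s₁) * (d₂ + s₂) * F ∎
  where
  open ≤-Reasoning
  expand : ∀ d₁ s₁ d₂ s₂ F → (d₁ + s₁) * (d₂ + s₂) * F ≡ d₁ * s₂ * F + s₁ * d₂ * F + d₁ * d₂ * F + s₁ * s₂ * F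
  expand = solve-∀

massBound : (q₁ q₂ Z B d₁ s₁ d₂ s₂ : ℕ) → ℕ
massBound q₁ q₂ Z B = massForm (suc q₁ * suc Z + q₂ * suc q₁ * B) (suc q₂ * suc Z + q₁ * suc q₂ * B)
                               (suc q₁ * suc q₂ * B) ((suc q₁ + q₂) * Z)

-- the reduced cross term of two profiles is dominated by the mass form of their masses;
-- each case is an exact identity up to a nonnegative slack
reduced≤massBound : ∀ {q₁ q₂ β₁ a₁ b₁ c₁ β₂ a₂ b₂ c₂} Z B →
  (π₁ : Profile (suc q₁) β₁ a₁ b₁ c₁) (π₂ : Profile (suc q₂) β₂ a₂ b₂ c₂) →
  reducedCross Z B a₁ b₁ c₁ a₂ b₂ c₂ ≤ massBound q₁ q₂ Z B (dMass π₁) (sMass π₁) (dMass π₂) (sMass π₂)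
reduced≤massBound {q₁} {q₂} Z B (partial d₁ s₁ _) (partial d₂ s₂ _) =
  ≤-reflexive (identity q₁ q₂ Z B d₁ s₁ d₂ s₂)
  where
  identity : ∀ q₁ q₂ Z B d₁ s₁ d₂ s₂ →
    (suc q₁ * d₁ * s₂ + s₁ * (suc q₂ * d₂)) * suc Z
      + (suc q₁ * d₁ * (suc q₂ * d₂) + suc q₁ * d₁ * (q₂ * s₂) + q₁ * s₁ * (suc q₂ * d₂)) * B
      + (s₁ * s₂ + s₁ * (q₂ * s₂) + q₁ * s₁ * s₂) * Z
    ≡ d₁ * s₂ * (suc q₁ * suc Z + q₂ * suc q₁ * B) + s₁ * d₂ * (suc q₂ * suc Z + q₁ * suc q₂ * B)
      + d₁ * d₂ * (suc q₁ * suc q₂ * B) + s₁ * s₂ * ((suc q₁ + q₂) * Z)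
  identity = solve-∀
reduced≤massBound {q₁} {q₂} Z B (partial d₁ s₁ _) (full (suc u₂) _) =
  ≤-trans (m≤m+n _ (s₁ + q₁ * s₁ * B)) (≤-reflexive (identity q₁ q₂ Z B d₁ s₁ u₂))
  where
  identity : ∀ q₁ q₂ Z B d₁ s₁ u₂ →
    (suc q₁ * d₁ * 0 + s₁ * (u₂ + q₂ * suc u₂)) * suc Z
      + (suc q₁ * d₁ * (u₂ + q₂ * suc u₂) + suc q₁ * d₁ * 1 + q₁ * s₁ * (u₂ + q₂ * suc u₂)) * B
      + (s₁ * 0 + s₁ * 1 + q₁ * s₁ * 0) * Z
      + (s₁ + q₁ * s₁ * B)
    ≡ d₁ * 0 * (suc q₁ * suc Z + q₂ * suc q₁ * B) + s₁ * suc u₂ * (suc q₂ * suc Z + q₁ * suc q₂ * B)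
      + d₁ * suc u₂ * (suc q₁ * suc q₂ * B) + s₁ * 0 * ((suc q₁ + q₂) * Z)
  identity = solve-∀
reduced≤massBound {q₁} {q₂} Z B (full (suc u₁) _) (partial d₂ s₂ _) =
  ≤-trans (m≤m+n _ (s₂ + q₂ * s₂ * B)) (≤-reflexive (identity q₁ q₂ Z B u₁ d₂ s₂))
  where
  identity : ∀ q₁ q₂ Z B u₁ d₂ s₂ →
    ((u₁ + q₁ * suc u₁) * s₂ + 0 * (suc q₂ * d₂)) * suc Z
      + ((u₁ + q₁ * suc u₁) * (suc q₂ * d₂) + (u₁ + q₁ * suc u₁) * (q₂ * s₂) + 1 * (suc q₂ * d₂)) * B
      + (0 * s₂ + 0 * (q₂ * s₂) + 1 * s₂) * Z
      + (s₂ + q₂ * s₂ * B)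
    ≡ suc u₁ * s₂ * (suc q₁ * suc Z + q₂ * suc q₁ * B) + 0 * d₂ * (suc q₂ * suc Z + q₁ * suc q₂ * B)
      + suc u₁ * d₂ * (suc q₁ * suc q₂ * B) + 0 * s₂ * ((suc q₁ + q₂) * Z)
  identity = solve-∀
reduced≤massBound {q₁} {q₂} Z B (full (suc u₁) _) (full (suc u₂) _) =
  ≤-trans (m≤m+n _ B) (≤-reflexive (identity q₁ q₂ Z B u₁ u₂))
  where
  identity : ∀ q₁ q₂ Z B u₁ u₂ →
    ((u₁ + q₁ * suc u₁) * 0 + 0 * (u₂ + q₂ * suc u₂)) * suc Z
      + ((u₁ + q₁ * suc u₁) * (u₂ + q₂ * suc u₂) + (u₁ + q₁ * suc u₁) * 1 + 1 * (u₂ + q₂ * suc u₂)) * B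
      + (0 * 0 + 0 * 1 + 1 * 0) * Z
      + B
    ≡ suc u₁ * 0 * (suc q₁ * suc Z + q₂ * suc q₁ * B) + 0 * suc u₂ * (suc q₂ * suc Z + q₁ * suc q₂ * B)
      + suc u₁ * suc u₂ * (suc q₁ * suc q₂ * B) + 0 * 0 * ((suc q₁ + q₂) * Z)
  identity = solve-∀

-- The coefficient inequalities; this is where p₃ ≥ 2p₂ + 1 enters, through (2p₂ + 1)·B ≤ X

slack-fits : ∀ c y p B X → y ≤ p → c + y ≤ c * suc p → 1 ≤ B → (2 * p + 1) * B ≤ X →
  c * y * B + (c + y) ≤ c * X
slack-fits c y p B X y≤p c+y≤ 1≤B [2p+1]B≤X = begin
  c * y * B + (c + y)            ≤⟨ +-mono-≤ (*-monoˡ-≤ B (*-monoʳ-≤ c y≤p)) (≤-trans c+y≤ c[p+1]≤c[p+1]B) ⟩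
  c * p * B + c * suc p * B      ≡⟨ collect c p B ⟩
  c * ((2 * p + 1) * B)          ≤⟨ *-monoʳ-≤ c [2p+1]B≤X ⟩
  c * X                          ∎
  where
  open ≤-Reasoning
  c[p+1]≤c[p+1]B : c * suc p ≤ c * suc p * B
  c[p+1]≤c[p+1]B = ≤-trans (≤-reflexive (sym (*-identityʳ (c * suc p)))) (*-monoʳ-≤ (c * suc p) 1≤B)
  collect : ∀ c p B → c * p * B + c * suc p * B ≡ c * ((2 * p + 1) * B)
  collect = solve-∀

coefficient-bound : ∀ c y p B Z → y ≤ p → c + y ≤ c * suc p → 1 ≤ B → (2 * p + 1) * B ≤ suc Z →
  y * suc Z + c * y * B ≤ (y + c) * Z
coefficient-bound c y p B Z y≤p c+y≤ 1≤B [2p+1]B≤ = +-cancelʳ-≤ (c + y) _ _ (begin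
  y * suc Z + c * y * B + (c + y)      ≡⟨ +-assoc (y * suc Z) _ _ ⟩
  y * suc Z + (c * y * B + (c + y))    ≤⟨ +-monoʳ-≤ (y * suc Z) (slack-fits c y p B (suc Z) y≤p c+y≤ 1≤B [2p+1]B≤) ⟩
  y * suc Z + c * suc Z                ≡⟨ regroup c y Z ⟩
  (y + c) * Z + (c + y)                ∎)
  where
  open ≤-Reasoning
  regroup : ∀ c y Z → y * suc Z + c * suc Z ≡ (y + c) * Z + (c + y)
  regroup = solve-∀

massBound-coefficients : ∀ q₁ q₂ B Z → 1 ≤ q₁ → q₁ < q₂ → 1 ≤ B → (2 * suc q₂ + 1) * B ≤ suc Z →
  suc q₁ * suc Z + q₂ * suc q₁ * B ≤ (suc q₁ + q₂) * Z ×
  suc q₂ * suc Z + q₁ * suc q₂ * B ≤ (suc q₁ + q₂) * Z ×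
  suc q₁ * suc q₂ * B ≤ (suc q₁ + q₂) * Z
massBound-coefficients q₁ q₂ B Z 1≤q₁ q₁<q₂ 1≤B [2p₂+1]B≤ = E₁≤F , E₂≤F , ≤-trans E₃≤E₂ E₂≤F
  where
  open ≤-Reasoning
  E₁≤F : suc q₁ * suc Z + q₂ * suc q₁ * B ≤ (suc q₁ + q₂) * Z
  E₁≤F = coefficient-bound q₂ (suc q₁) (suc q₂) B Z (≤-trans q₁<q₂ (n≤1+n q₂)) q₂+p₁≤ 1≤B [2p₂+1]B≤
    where
    q₂+p₁≤ : q₂ + suc q₁ ≤ q₂ * suc (suc q₂)
    q₂+p₁≤ = begin
      q₂ + suc q₁                 ≤⟨ +-monoʳ-≤ q₂ q₁<q₂ ⟩
      q₂ + q₂                     ≤⟨ +-monoʳ-≤ q₂ (m≤m*n q₂ (suc q₂)) ⟩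
      q₂ + q₂ * suc q₂            ≡⟨ *-suc q₂ (suc q₂) ⟨
      q₂ * suc (suc q₂)           ∎
  E₂≤F : suc q₂ * suc Z + q₁ * suc q₂ * B ≤ (suc q₁ + q₂) * Z
  E₂≤F = begin
    suc q₂ * suc Z + q₁ * suc q₂ * B   ≤⟨ coefficient-bound q₁ (suc q₂) (suc q₂) B Z ≤-refl q₁+p₂≤ 1≤B [2p₂+1]B≤ ⟩
    (suc q₂ + q₁) * Z                  ≡⟨ cong (λ m → suc m * Z) (+-comm q₂ q₁) ⟩
    (suc q₁ + q₂) * Z                  ∎
    where
    q₁+p₂≤ : q₁ + suc q₂ ≤ q₁ * suc (suc q₂)
    q₁+p₂≤ = begin
      q₁ + suc q₂                 ≤⟨ +-monoʳ-≤ q₁ (≤-trans (≤-reflexive (sym (*-identityˡ (suc q₂)))) (*-monoˡ-≤ (suc q₂) 1≤q₁)) ⟩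
      q₁ + (q₁ * suc q₂)          ≡⟨ *-suc q₁ (suc q₂) ⟨
      q₁ * suc (suc q₂)           ∎
  E₃≤E₂ : suc q₁ * suc q₂ * B ≤ suc q₂ * suc Z + q₁ * suc q₂ * B
  E₃≤E₂ = begin
    suc q₁ * suc q₂ * B                ≡⟨ *-distribʳ-+ B (suc q₂) (q₁ * suc q₂) ⟩
    suc q₂ * B + q₁ * suc q₂ * B       ≤⟨ +-monoˡ-≤ (q₁ * suc q₂ * B) (*-monoʳ-≤ (suc q₂) B≤1+Z) ⟩
    suc q₂ * suc Z + q₁ * suc q₂ * B   ∎
    where
    B≤1+Z : B ≤ suc Z
    B≤1+Z = ≤-trans (m≤n*m B (2 * suc q₂ + 1)) [2p₂+1]B≤

crossTerm-bound : ∀ {p₁ p₂ Z B β₁ a₁ b₁ c₁ β₂ a₂ b₂ c₂ a₃ b₃ c₃} → 2 ≤ p₁ → p₁ < p₂ →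
  1 ≤ B → (2 * p₂ + 1) * B ≤ suc Z →
  Profile p₁ β₁ a₁ b₁ c₁ → Profile p₂ β₂ a₂ b₂ c₂ → a₃ + b₃ + c₃ ≡ suc Z → 1 ≤ c₃ → b₃ ≤ B →
  crossTerm a₁ b₁ c₁ a₂ b₂ c₂ a₃ b₃ c₃ ≤ β₁ * β₂ * ((p₁ + pred p₂) * Z)
crossTerm-bound {suc q₁} {suc q₂} {Z} {B} {β₁} {a₁} {b₁} {c₁} {β₂} {a₂} {b₂} {c₂} {a₃} {b₃} {c₃} 2≤p₁ p₁<p₂ 1≤B [2p₂+1]B≤ π₁ π₂ sum 1≤c₃ b₃≤B
  with massBound-coefficients q₁ q₂ B Z (s≤s⁻¹ 2≤p₁) (s≤s⁻¹ p₁<p₂) 1≤B [2p₂+1]B≤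
... | E₁≤F , E₂≤F , E₃≤F = begin
  crossTerm a₁ b₁ c₁ a₂ b₂ c₂ a₃ b₃ c₃             ≤⟨ crossTerm≤reduced {a₁ = a₁} {b₁} {c₁} {a₂} {b₂} {c₂} sum 1≤c₃ b₃≤B ⟩
  reducedCross Z B a₁ b₁ c₁ a₂ b₂ c₂                ≤⟨ reduced≤massBound Z B π₁ π₂ ⟩
  massBound q₁ q₂ Z B d₁ s₁ d₂ s₂                   ≤⟨ massForm-bound d₁ s₁ d₂ s₂ E₁≤F E₂≤F E₃≤F ⟩
  (d₁ + s₁) * (d₂ + s₂) * ((suc q₁ + q₂) * Z)       ≡⟨ cong₂ (λ u v → u * v * ((suc q₁ + q₂) * Z)) (mass-total π₁) (mass-total π₂) ⟩
  β₁ * β₂ * ((suc q₁ + q₂) * Z)                     ∎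
  where
  open ≤-Reasoning
  d₁ = dMass π₁
  s₁ = sMass π₁
  d₂ = dMass π₂
  s₂ = sMass π₂

-- the cross term at the vertex p₃^α₃, whose local exponents are (0, 0, α₃)
crossTerm-target : ∀ p₁ p₂ β₁ β₂ Z .{{_ : NonZero p₁}} →
  crossTerm 0 β₁ (pred p₁ * β₁) 0 β₂ (pred p₂ * β₂) Z 0 1 ≡ β₁ * β₂ * ((p₁ + pred p₂) * Z)
crossTerm-target (suc q₁) p₂ β₁ β₂ Z = identity q₁ (pred p₂) β₁ β₂ Z
  where
  identity : ∀ q₁ q₂ β₁ β₂ Z →
    (0 * β₂ + β₁ * 0) * (Z + 0 + 1) + (0 * 0 + 0 * (q₂ * β₂) + q₁ * β₁ * 0) * 0
      + (β₁ * β₂ + β₁ * (q₂ * β₂) + q₁ * β₁ * β₂) * Z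
    ≡ β₁ * β₂ * ((suc q₁ + q₂) * Z)
  identity = solve-∀

cancel-common : ∀ {U C M T K N} → U + C ≡ M + T → T + M + K ≡ N + C → U + K ≡ N
cancel-common {U} {C} {M} {T} {K} {N} e₁ e₂ = +-cancelʳ-≡ C _ _ (begin
  U + K + C     ≡⟨ +-assoc U K C ⟩
  U + (K + C)   ≡⟨ cong (U +_) (+-comm K C) ⟩
  U + (C + K)   ≡⟨ +-assoc U C K ⟨
  U + C + K     ≡⟨ cong (_+ K) (trans e₁ (+-comm M T)) ⟩
  T + M + K     ≡⟨ e₂ ⟩
  N + C         ∎)
  where open ≡-Reasoning

compare-complements : ∀ {u v K K' N} → u + K ≡ N → v + K' ≡ N → K' ≤ K → u ≤ v
compare-complements {u} {v} {K} {K'} eu ev K'≤K = +-cancelʳ-≤ K' u v (begin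
  u + K'   ≤⟨ +-monoʳ-≤ u K'≤K ⟩
  u + K    ≡⟨ trans eu (sym ev) ⟩
  v + K'   ∎)
  where open ≤-Reasoning

module ThreePrimes (p₁ p₂ p₃ α₁ α₂ α₃ : ℕ) (pp₁ : Prime p₁) (pp₂ : Prime p₂) (pp₃ : Prime p₃)
                   (p₁≢p₂ : p₁ ≢ p₂) (p₁≢p₃ : p₁ ≢ p₃) (p₂≢p₃ : p₂ ≢ p₃) where

  x₁ x₂ x₃ n : ℕ
  x₁ = p₁ ^ α₁
  x₂ = p₂ ^ α₂
  x₃ = p₃ ^ α₃
  n  = x₁ * x₂ * x₃

  instance
    p₁≢0 : NonZero p₁
    p₁≢0 = prime⇒nonZero pp₁
    p₂≢0 : NonZero p₂
    p₂≢0 = prime⇒nonZero pp₂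
    p₃≢0 : NonZero p₃
    p₃≢0 = prime⇒nonZero pp₃
    x₁≢0 : NonZero x₁
    x₁≢0 = m^n≢0 p₁ α₁
    x₂≢0 : NonZero x₂
    x₂≢0 = m^n≢0 p₂ α₂
    x₃≢0 : NonZero x₃
    x₃≢0 = m^n≢0 p₃ α₃
    x₁x₂≢0 : NonZero (x₁ * x₂)
    x₁x₂≢0 = m*n≢0 x₁ x₂
    n≢0 : NonZero n
    n≢0 = m*n≢0 (x₁ * x₂) x₃

  coprime₁₂ : ∀ e₁ e₂ → Coprime (p₁ ^ e₁) (p₂ ^ e₂)
  coprime₁₂ e₁ e₂ = coprime-pow e₁ pp₁ (λ h → p₁≢p₂ (prime∣pow⇒≡ e₂ pp₁ pp₂ h))

  coprime₁₂₃ : ∀ e₁ e₂ e₃ → Coprime (p₁ ^ e₁ * p₂ ^ e₂) (p₃ ^ e₃)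
  coprime₁₂₃ e₁ e₂ e₃ =
    Coprime-sym (coprime-pow e₃ pp₃ (prime∤pow*pow e₁ e₂ pp₃ pp₁ pp₂ (≢-sym p₁≢p₃) (≢-sym p₂≢p₃)))

  inBox : (P₁ P₂ P₃ : ℕ → Bool) → ℕ → Bool
  inBox P₁ P₂ P₃ b = (P₁ (b % x₁) ∧ P₂ (b % x₂)) ∧ P₃ (b % x₃)

  count-inBox : ∀ (P₁ P₂ P₃ : ℕ → Bool) → count n (inBox P₁ P₂ P₃) ≡ count x₁ P₁ * count x₂ P₂ * count x₃ P₃
  count-inBox P₁ P₂ P₃ = begin
    count n (inBox P₁ P₂ P₃)
      ≡⟨ count-cong n (λ b _ → cong (_∧ P₃ (b % x₃)) (cong₂ (λ u v → P₁ u ∧ P₂ v)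
           (sym (m∣n⇒o%n%m≡o%m x₁ (x₁ * x₂) b (m∣m*n x₂))) (sym (m∣n⇒o%n%m≡o%m x₂ (x₁ * x₂) b (n∣m*n x₁))))) ⟩
    count n (λ b → P₁₂ (b % (x₁ * x₂)) ∧ P₃ (b % x₃))
      ≡⟨ ChineseCount.count-× (x₁ * x₂) x₃ (coprime₁₂₃ α₁ α₂ α₃) P₁₂ P₃ ⟩
    count (x₁ * x₂) P₁₂ * count x₃ P₃
      ≡⟨ cong (_* count x₃ P₃) (ChineseCount.count-× x₁ x₂ (coprime₁₂ α₁ α₂) P₁ P₂) ⟩
    count x₁ P₁ * count x₂ P₂ * count x₃ P₃ ∎
    where
    open ≡-Reasoning
    P₁₂ : ℕ → Bool
    P₁₂ c = P₁ (c % x₁) ∧ P₂ (c % x₂)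

  inBox-∧ : ∀ P₁ P₂ P₃ Q₁ Q₂ Q₃ b →
    inBox P₁ P₂ P₃ b ∧ inBox Q₁ Q₂ Q₃ b ≡ inBox (λ r → P₁ r ∧ Q₁ r) (λ r → P₂ r ∧ Q₂ r) (λ r → P₃ r ∧ Q₃ r) b
  inBox-∧ P₁ P₂ P₃ Q₁ Q₂ Q₃ b =
    trans (∧-interchange (P₁ (b % x₁) ∧ P₂ (b % x₂)) (P₃ (b % x₃)) (Q₁ (b % x₁) ∧ Q₂ (b % x₂)) (Q₃ (b % x₃)))
          (cong (_∧ (P₃ (b % x₃) ∧ Q₃ (b % x₃))) (∧-interchange (P₁ (b % x₁)) (P₂ (b % x₂)) (Q₁ (b % x₁)) (Q₂ (b % x₂))))

  -- For the divisor d = p₁^e₁ p₂^e₂ p₃^e₃ of n: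
  --   multiplesBox e : the b with d ∣ b,   divisorsBox e : the b with gcd(b, n) ∣ d,
  -- and their union neighbourBox e approximates the closed neighbourhood of any a with gcd(a, n) = d.
  multiplesBox divisorsBox neighbourBox : ℕ → ℕ → ℕ → ℕ → Bool
  multiplesBox e₁ e₂ e₃ = inBox (atLeast p₁ e₁) (atLeast p₂ e₂) (atLeast p₃ e₃)
  divisorsBox  e₁ e₂ e₃ = inBox (atMost p₁ α₁ e₁) (atMost p₂ α₂ e₂) (atMost p₃ α₃ e₃)
  neighbourBox e₁ e₂ e₃ b = multiplesBox e₁ e₂ e₃ b ∨ divisorsBox e₁ e₂ e₃ b

  crossAt : ∀ {e₁ e₂ e₃} → LocalCounts p₁ α₁ e₁ → LocalCounts p₂ α₂ e₂ → LocalCounts p₃ α₃ e₃ → ℕ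
  crossAt L₁ L₂ L₃ = crossTerm (a L₁) (b L₁) (c L₁) (a L₂) (b L₂) (c L₂) (a L₃) (b L₃) (c L₃)
    where open LocalCounts

  neighbourBox-size : ∀ {e₁ e₂ e₃} (L₁ : LocalCounts p₁ α₁ e₁) (L₂ : LocalCounts p₂ α₂ e₂) (L₃ : LocalCounts p₃ α₃ e₃) →
    count n (neighbourBox e₁ e₂ e₃) + crossAt L₁ L₂ L₃ ≡ n
  neighbourBox-size {e₁} {e₂} {e₃} L₁ L₂ L₃ = cancel-common {M = #M} {T = #T} inclusion-exclusion (begin
    #T + #M + crossAt L₁ L₂ L₃
      ≡⟨ crossTerm-identity a₁ b₁ c₁ a₂ b₂ c₂ a₃ b₃ c₃ ⟩
    (a₁ + b₁ + c₁) * (a₂ + b₂ + c₂) * (a₃ + b₃ + c₃) + c₁ * c₂ * c₃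
      ≡⟨ cong (_+ c₁ * c₂ * c₃) (cong₂ _*_ (cong₂ _*_ (side L₁) (side L₂)) (side L₃)) ⟩
    n + c₁ * c₂ * c₃ ∎)
    where
    open ≡-Reasoning
    open LocalCounts L₁ using () renaming (a to a₁; b to b₁; c to c₁)
    open LocalCounts L₂ using () renaming (a to a₂; b to b₂; c to c₂)
    open LocalCounts L₃ using () renaming (a to a₃; b to b₃; c to c₃)
    side : ∀ {p α e} .{{_ : NonZero p}} (L : LocalCounts p α e) →
      LocalCounts.a L + LocalCounts.b L + LocalCounts.c L ≡ p ^ α
    side L = trans (profile-total (LocalCounts.profile L)) (sym (LocalCounts.size L))
    #M #T : ℕ
    #M = (b₁ + c₁) * (b₂ + c₂) * (b₃ + c₃)
    #T = (a₁ + c₁) * (a₂ + c₂) * (a₃ + c₃)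
    Mb Tb : ℕ → Bool
    Mb = multiplesBox e₁ e₂ e₃
    Tb = divisorsBox e₁ e₂ e₃
    inclusion-exclusion : count n (neighbourBox e₁ e₂ e₃) + c₁ * c₂ * c₃ ≡ #M + #T
    inclusion-exclusion = begin
      count n (λ b → Mb b ∨ Tb b) + c₁ * c₂ * c₃
        ≡⟨ cong (count n (λ b → Mb b ∨ Tb b) +_) (sym (trans (count-cong n (λ b _ → inBox-∧ (atLeast p₁ e₁) (atLeast p₂ e₂) (atLeast p₃ e₃) (atMost p₁ α₁ e₁) (atMost p₂ α₂ e₂) (atMost p₃ α₃ e₃) b))
             (trans (count-inBox _ _ _) (cong₂ _*_ (cong₂ _*_ (#both L₁) (#both L₂)) (#both L₃))))) ⟩
      count n (λ b → Mb b ∨ Tb b) + count n (λ b → Mb b ∧ Tb b)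
        ≡⟨ count-∨ n Mb Tb ⟩
      count n Mb + count n Tb
        ≡⟨ cong₂ _+_ (trans (count-inBox _ _ _) (cong₂ _*_ (cong₂ _*_ (#atLeast L₁) (#atLeast L₂)) (#atLeast L₃)))
                     (trans (count-inBox _ _ _) (cong₂ _*_ (cong₂ _*_ (#atMost L₁) (#atMost L₂)) (#atMost L₃))) ⟩
      #M + #T ∎
      where open LocalCounts

  multiplesBox⇒∣ : ∀ {e₁ e₂ e₃} b → e₁ ≤ α₁ → e₂ ≤ α₂ → e₃ ≤ α₃ → multiplesBox e₁ e₂ e₃ b ≡ true →
    p₁ ^ e₁ * p₂ ^ e₂ * p₃ ^ e₃ ∣ b
  multiplesBox⇒∣ {e₁} {e₂} {e₃} b e₁≤ e₂≤ e₃≤ h with ∧-true⇒ h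
  ... | h₁₂ , h₃ with ∧-true⇒ h₁₂
  ... | h₁ , h₂ = coprime-∣⇒*∣ (coprime₁₂₃ e₁ e₂ e₃)
                    (coprime-∣⇒*∣ (coprime₁₂ e₁ e₂) (atLeast⇒∣ p₁ α₁ e₁ b e₁≤ h₁) (atLeast⇒∣ p₂ α₂ e₂ b e₂≤ h₂))
                    (atLeast⇒∣ p₃ α₃ e₃ b e₃≤ h₃)

  divisorsBox⇒gcd∣ : ∀ {e₁ e₂ e₃} b → divisorsBox e₁ e₂ e₃ b ≡ true → gcd b n ∣ p₁ ^ e₁ * p₂ ^ e₂ * p₃ ^ e₃
  divisorsBox⇒gcd∣ {e₁} {e₂} {e₃} b h with ∧-true⇒ h
  ... | h₁₂ , h₃ with ∧-true⇒ h₁₂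
  ... | h₁ , h₂ with divisor-of-three-powers pp₁ pp₂ pp₃ p₁≢p₂ p₁≢p₃ p₂≢p₃ (gcd[m,n]∣n b n)
  ... | f₁ , f₂ , f₃ , f₁≤ , f₂≤ , f₃≤ , g≡ = subst (_∣ p₁ ^ e₁ * p₂ ^ e₂ * p₃ ^ e₃) (sym g≡)
          (*-pres-∣ (*-pres-∣ (pow-∣ p₁ (atMost⇒≤ p₁ α₁ e₁ f₁ b h₁ f₁≤ (∣-trans (∣m⇒∣m*n (p₃ ^ f₃) (m∣m*n (p₂ ^ f₂))) g∣b)))
                              (pow-∣ p₂ (atMost⇒≤ p₂ α₂ e₂ f₂ b h₂ f₂≤ (∣-trans (∣m⇒∣m*n (p₃ ^ f₃) (n∣m*n (p₁ ^ f₁))) g∣b))))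
                    (pow-∣ p₃ (atMost⇒≤ p₃ α₃ e₃ f₃ b h₃ f₃≤ (∣-trans (n∣m*n (p₁ ^ f₁ * p₂ ^ f₂)) g∣b))))
    where
    g∣b : p₁ ^ f₁ * p₂ ^ f₂ * p₃ ^ f₃ ∣ b
    g∣b = subst (_∣ b) g≡ (gcd[m,n]∣m b n)

  neighbourBox⊆closed : ∀ a {e₁ e₂ e₃} → e₁ ≤ α₁ → e₂ ≤ α₂ → e₃ ≤ α₃ → gcd a n ≡ p₁ ^ e₁ * p₂ ^ e₂ * p₃ ^ e₃ →
    ∀ b → b < n → neighbourBox e₁ e₂ e₃ b ≡ true → closedAdjacent n a b ≡ true
  neighbourBox⊆closed a e₁≤ e₂≤ e₃≤ g≡ b _ h with ∨-true⇒ h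
  ... | inj₁ multiple = ∨-trueˡ (dec-true (gcd a n ∣? b) (subst (_∣ b) (sym g≡) (multiplesBox⇒∣ b e₁≤ e₂≤ e₃≤ multiple)))
  ... | inj₂ divisor  = ∨-trueʳ (dec-true (gcd b n ∣? a)
                          (∣-trans (divisorsBox⇒gcd∣ b divisor) (subst (_∣ a) g≡ (gcd[m,n]∣m a n))))

  closed⊆neighbourBox : 1 ≤ α₁ → 1 ≤ α₂ → ∀ b → b < n → closedAdjacent n x₃ b ≡ true → neighbourBox 0 0 α₃ b ≡ true
  closed⊆neighbourBox 1≤α₁ 1≤α₂ b _ h with ∨-true⇒ h
  ... | inj₁ gcd∣b = ∨-trueˡ {y = divisorsBox 0 0 α₃ b}
                       (∧-true⇐ (∧-true⇐ (dec-true (1 ∣? (b % x₁)) (1∣ _)) (dec-true (1 ∣? (b % x₂)) (1∣ _)))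
                                      (∣⇒atLeast p₃ α₃ b x₃∣b))
    where
    x₃∣b : x₃ ∣ b
    x₃∣b = ∣-trans (gcd-greatest ∣-refl (n∣m*n (x₁ * x₂))) (does-true⇒ (gcd x₃ n ∣? b) gcd∣b)
  ... | inj₂ b∣x₃ = ∨-trueʳ {multiplesBox 0 0 α₃ b} (∧-true⇐ (∧-true⇐ (coprimeAt pp₁ p₁≢p₃ 1≤α₁ (∣m⇒∣m*n x₃ (m∣m*n x₂)))
                                               (coprimeAt pp₂ p₂≢p₃ 1≤α₂ (∣m⇒∣m*n x₃ (n∣m*n x₁))))
                                     (∨-trueˡ (≡ᵇ-true α₃ α₃ refl)))
    where
    -- a prime p ≠ p₃ dividing n cannot divide gcd(b, n) ∣ p₃^α₃, so b is a unit at p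
    coprimeAt : ∀ {p α} .{{_ : NonZero (p ^ α)}} → Prime p → p ≢ p₃ → 1 ≤ α → p ^ α ∣ n → atMost p α 0 (b % p ^ α) ≡ true
    coprimeAt {p} {α} pp p≢p₃ 1≤α p^α∣n = ∨-trueʳ (cong not (dec-false (p ^ 1 ∣? _) p∤b%x))
      where
      p∤b%x : ¬ p ^ 1 ∣ b % p ^ α
      p∤b%x p∣b%x = p≢p₃ (prime∣pow⇒≡ α₃ pp pp₃
        (∣-trans (m∣m*n 1) (∣-trans (gcd-greatest (∣n∣m%n⇒∣m (pow-∣ p 1≤α) p∣b%x) (∣-trans (pow-∣ p 1≤α) p^α∣n))
                                    (does-true⇒ (gcd b n ∣? x₃) b∣x₃))))

  crossAt-target : (B₁ : LocalCounts p₁ α₁ 0) (B₂ : LocalCounts p₂ α₂ 0) (T₃ : LocalCounts p₃ α₃ α₃) →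
    crossAt B₁ B₂ T₃ ≡ LocalCounts.β B₁ * LocalCounts.β B₂ * ((p₁ + pred p₂) * LocalCounts.a T₃)
  crossAt-target B₁ B₂ T₃
    with localCounts-bottom (prime≥2 pp₁) B₁ | localCounts-bottom (prime≥2 pp₂) B₂ | localCounts-top-values T₃
  ... | a₁≡0 , b₁≡β₁ , c₁≡ | a₂≡0 , b₂≡β₂ , c₂≡ | _ , b₃≡0 , c₃≡1
    rewrite a₁≡0 | c₁≡ | b₁≡β₁ | a₂≡0 | c₂≡ | b₂≡β₂ | b₃≡0 | c₃≡1 =
    crossTerm-target p₁ p₂ (LocalCounts.β B₁) (LocalCounts.β B₂) (LocalCounts.a T₃)

  crossAt-bound : p₁ < p₂ → 2 * p₂ + 1 ≤ p₃ → ∀ {e₁ e₂ e₃}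
    (L₁ : LocalCounts p₁ α₁ e₁) (L₂ : LocalCounts p₂ α₂ e₂) (L₃ : LocalCounts p₃ α₃ e₃)
    (B₁ : LocalCounts p₁ α₁ 0) (B₂ : LocalCounts p₂ α₂ 0) (T₃ : LocalCounts p₃ α₃ α₃) →
    crossAt L₁ L₂ L₃ ≤ crossAt B₁ B₂ T₃
  crossAt-bound p₁<p₂ [2p₂+1]≤p₃ L₁ L₂ L₃ B₁ B₂ T₃ = begin
    crossAt L₁ L₂ L₃
      ≤⟨ crossTerm-bound (prime≥2 pp₁) p₁<p₂ (profile-β≥1 (profile L₃)) [2p₂+1]β₃≤ (profile L₁) (profile L₂)
                         sum₃ (profile-c≥1 (prime≥2 pp₃) (profile L₃)) (profile-b≤β (profile L₃)) ⟩
    β L₁ * β L₂ * ((p₁ + pred p₂) * a T₃)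
      ≡⟨ cong₂ (λ u v → u * v * ((p₁ + pred p₂) * a T₃)) (β-unique L₁ B₁) (β-unique L₂ B₂) ⟩
    β B₁ * β B₂ * ((p₁ + pred p₂) * a T₃)
      ≡⟨ crossAt-target B₁ B₂ T₃ ⟨
    crossAt B₁ B₂ T₃ ∎
    where
    open LocalCounts
    open ≤-Reasoning
    -- the third coordinate has total p₃^α₃ = Z + 1 with Z = a T₃
    1+Z≡ : suc (a T₃) ≡ p₃ * β L₃
    1+Z≡ = trans (proj₁ (localCounts-top-values T₃)) (trans (sym (size T₃)) (size L₃))
    sum₃ : a L₃ + b L₃ + c L₃ ≡ suc (a T₃)
    sum₃ = trans (profile-total (profile L₃)) (sym 1+Z≡)
    [2p₂+1]β₃≤ : (2 * p₂ + 1) * β L₃ ≤ suc (a T₃)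
    [2p₂+1]β₃≤ = ≤-trans (*-monoˡ-≤ (β L₃) [2p₂+1]≤p₃) (≤-reflexive (sym 1+Z≡))

  x₃<n : 1 ≤ α₁ → x₃ < n
  x₃<n 1≤α₁ = begin-strict
    x₃              <⟨ m<m*n x₃ x₁ (^-monoʳ-< p₁ (prime≥2 pp₁) 1≤α₁) ⟩
    x₃ * x₁         ≡⟨ *-comm x₃ x₁ ⟩
    x₁ * x₃         ≤⟨ *-monoˡ-≤ x₃ (m≤m*n x₁ x₂) ⟩
    n               ∎
    where open ≤-Reasoning

  deg-x₃-minimal : 1 ≤ α₁ → 1 ≤ α₂ → 1 ≤ α₃ → p₁ < p₂ → 2 * p₂ + 1 ≤ p₃ → ∀ a → a < n → deg n x₃ ≤ deg n a
  deg-x₃-minimal 1≤α₁ 1≤α₂ 1≤α₃ p₁<p₂ [2p₂+1]≤p₃ a a<n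
    with divisor-of-three-powers pp₁ pp₂ pp₃ p₁≢p₂ p₁≢p₃ p₂≢p₃ (gcd[m,n]∣n a n)
  ... | e₁ , e₂ , e₃ , e₁≤ , e₂≤ , e₃≤ , gcd≡ = +-cancelʳ-≤ 1 (deg n x₃) (deg n a) (begin
    deg n x₃ + 1                      ≡⟨ deg+1 n x₃ (x₃<n 1≤α₁) ⟩
    count n (closedAdjacent n x₃)     ≤⟨ count-mono n (closed⊆neighbourBox 1≤α₁ 1≤α₂) ⟩
    count n (neighbourBox 0 0 α₃)     ≤⟨ compare-complements (neighbourBox-size B₁ B₂ T₃) (neighbourBox-size L₁ L₂ L₃)
                                                             (crossAt-bound p₁<p₂ [2p₂+1]≤p₃ L₁ L₂ L₃ B₁ B₂ T₃) ⟩
    count n (neighbourBox e₁ e₂ e₃)   ≤⟨ count-mono n (neighbourBox⊆closed a e₁≤ e₂≤ e₃≤ gcd≡) ⟩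
    count n (closedAdjacent n a)      ≡⟨ deg+1 n a a<n ⟨
    deg n a + 1                       ∎)
    where
    open ≤-Reasoning
    L₁ = localCounts p₁ α₁ e₁ e₁≤ 1≤α₁
    L₂ = localCounts p₂ α₂ e₂ e₂≤ 1≤α₂
    L₃ = localCounts p₃ α₃ e₃ e₃≤ 1≤α₃
    B₁ = localCounts p₁ α₁ 0 z≤n 1≤α₁
    B₂ = localCounts p₂ α₂ 0 z≤n 1≤α₂
    T₃ = localCounts p₃ α₃ α₃ ≤-refl 1≤α₃

minDeg-attained : ∀ n .{{_ : NonZero n}} v → v < n → (∀ a → a < n → deg n v ≤ deg n a) → minDeg n ≡ deg n v
minDeg-attained n v v<n minimal = ≤-antisym atMostV atLeastV
  where
  atMostV : minDeg n ≤ deg n v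
  atMostV = foldr-preservesᵒ {P = _≤ deg n v} ⊓-pres (deg n 0) (map (deg n) (upTo n))
              (inj₂ (Any-map⁺ (lose (∈-upTo⁺ v<n) ≤-refl)))
    where
    ⊓-pres : ∀ x y → x ≤ deg n v ⊎ y ≤ deg n v → x ⊓ y ≤ deg n v
    ⊓-pres x y (inj₁ x≤) = ≤-trans (m⊓n≤m x y) x≤
    ⊓-pres x y (inj₂ y≤) = ≤-trans (m⊓n≤n x y) y≤
  atLeastV : deg n v ≤ minDeg n
  atLeastV = foldr-preservesᵇ {P = deg n v ≤_} ⊓-glb (minimal 0 (>-nonZero⁻¹ n))
               (All-map⁺ (applyUpTo⁺₁ (λ i → i) n (λ {i} → minimal i)))

corollary5p3 : (p₁ p₂ p₃ α₁ α₂ α₃ n : ℕ) → .{{_ : NonZero n}} →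
    Prime p₁ → Prime p₂ → Prime p₃ → p₁ < p₂ → p₂ < p₃ →
    1 ≤ α₁ → 1 ≤ α₂ → 1 ≤ α₃ →
    n ≡ p₁ ^ α₁ * p₂ ^ α₂ * p₃ ^ α₃ →
    2 * p₂ + 1 ≤ p₃ →
    minDeg n ≡ deg n ((p₃ ^ α₃) % n)
corollary5p3 p₁ p₂ p₃ α₁ α₂ α₃ .(p₁ ^ α₁ * p₂ ^ α₂ * p₃ ^ α₃) pp₁ pp₂ pp₃ p₁<p₂ p₂<p₃ 1≤α₁ 1≤α₂ 1≤α₃ refl [2p₂+1]≤p₃ =
  begin
    minDeg n         ≡⟨ minDeg-attained n x₃ (x₃<n 1≤α₁) (deg-x₃-minimal 1≤α₁ 1≤α₂ 1≤α₃ p₁<p₂ [2p₂+1]≤p₃) ⟩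
    deg n x₃         ≡⟨ cong (deg n) (m<n⇒m%n≡m (x₃<n 1≤α₁)) ⟨
    deg n (x₃ % n)   ∎
  where
  open ≡-Reasoning
  open ThreePrimes p₁ p₂ p₃ α₁ α₂ α₃ pp₁ pp₂ pp₃ (<⇒≢ p₁<p₂) (<⇒≢ (<-trans p₁<p₂ p₂<p₃)) (<⇒≢ p₂<p₃)
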